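{- Let $n, r \geq 1$. Then: (i) $\mathcal{S}_{(r,n)}(x) = \sum_{k=0}^{n} \frac{(n)_k}{(r+k)_k} (-1)^k x^{n-k}$; (ii) $\mathcal{S}_{(r,n)}(x) = r \int_{0}^{1} (x-t)^n (1-t)^{r-1}\, dt$; (iii) $\frac{d}{dx}\mathcal{S}_{(r,n)}(x) = n\, \mathcal{S}_{(r,n-1)}(x)$; (iv) $\mathcal{S}_{(r,n)}(x + y) = \sum_{k=0}^{n} \binom{n}{k} \mathcal{S}_{(r,k)}(x)\, y^{n-k}$; (v) $\operatorname{denom}\left( \mathcal{S}_{(r,n)}(x) \right) = \binom{r+n}{r}$; (vi) for every $\ell \in \mathbb{Z}$, $\operatorname{denom}\left( \mathcal{S}_{(r,n)}(\ell) \right) \mid \binom{r+n}{r}$. In particular, $(\mathcal{S}_{(r,n)}(x))_{n \geq 0}$ is an Appell sequence, with (iii) and (iv) equivalent.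
   Context: For integers $n, r \geq 0$, $\mathcal{S}_{(r,n)}(x) = \sum_{k=0}^{n} \binom{n}{k} (-1)^k x^{n-k} \binom{r+k}{r}^{ -1} \in \mathbb{Q}[x]$ (so $\mathcal{S}_{(r,0)}(x)=1$). $(n)_k = n(n-1)\cdots(n-k+1)$ is the falling factorial. For a polynomial $f \in \mathbb{Q}[x]$, $\operatorname{denom}(f)$ is the smallest positive integer $d$ with $d f \in \mathbb{Z}[x]$; for a rational number this is the usual denominator. -}

module Defs where

open import Data.Nat as ℕ using (ℕ; zero; suc)
open import Data.Integer as ℤ using (ℤ; +_)
open import Data.Rational using (ℚ; _/_; 0ℚ; 1ℚ; _+_; _*_; -_; ↧ₙ_)
open import Data.List using (List; []; _∷_; map; upTo; foldr; replicate; _++_)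
open import Data.Product using (_×_)
open import Relation.Binary.PropositionalEquality using (_≡_)

-- Univariate polynomials over ℚ: coefficient lists, lowest degree first.
Poly : Set
Poly = List ℚ

coeff : Poly → ℕ → ℚ
coeff []       _       = 0ℚ
coeff (a ∷ _)  zero    = a
coeff (_ ∷ as) (suc i) = coeff as i

infix 4 _≈P_
_≈P_ : Poly → Poly → Set
p ≈P q = ∀ i → coeff p i ≡ coeff q i

ℕtoℚ : ℕ → ℚ
ℕtoℚ m = (+ m) / 1

-- 1/m for a positive natural m (only ever applied to m ≥ 1; value at 0 is irrelevant)
invℕ : ℕ → ℚ
invℕ zero    = 0ℚ
invℕ (suc m) = (+ 1) / suc m

_^Q_ : ℚ → ℕ → ℚ
q ^Q zero  = 1ℚ
q ^Q suc k = q * (q ^Q k)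

ff : ℕ → ℕ → ℕ
ff n zero    = 1
ff n (suc k) = n ℕ.* ff (n ℕ.∸ 1) k

addP : Poly → Poly → Poly
addP []       q        = q
addP (a ∷ p)  []       = a ∷ p
addP (a ∷ p)  (b ∷ q)  = (a + b) ∷ addP p q

scaleP : ℚ → Poly → Poly
scaleP c p = map (c *_) p

mulP : Poly → Poly → Poly
mulP []      q = []
mulP (a ∷ p) q = addP (scaleP a q) (0ℚ ∷ mulP p q)

powP : Poly → ℕ → Poly
powP p zero    = 1ℚ ∷ []
powP p (suc k) = mulP p (powP p k)

monomial : ℚ → ℕ → Poly
monomial c m = replicate m 0ℚ ++ (c ∷ [])

sumP : List Poly → Poly
sumP = foldr addP []

evalP : Poly → ℚ → ℚ
evalP []      x = 0ℚ
evalP (a ∷ p) x = a + x * evalP p x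

compP : Poly → Poly → Poly
compP []      q = []
compP (a ∷ p) q = addP (a ∷ []) (mulP q (compP p q))

derivAux : ℕ → Poly → Poly
derivAux k []      = []
derivAux k (b ∷ p) = (ℕtoℚ k * b) ∷ derivAux (suc k) p

deriv : Poly → Poly
deriv []      = []
deriv (_ ∷ p) = derivAux 1 p

integralAux : ℕ → Poly → ℚ
integralAux i []      = 0ℚ
integralAux i (a ∷ p) = a * invℕ (suc i) + integralAux (suc i) p

integral01 : Poly → ℚ
integral01 = integralAux 0

S : ℕ → ℕ → Poly
S r n = sumP (map (λ k → monomial (ℕtoℚ (n C k) * ((- 1ℚ) ^Q k) * invℕ ((r ℕ.+ k) C r)) (n ℕ.∸ k))
                  (upTo (suc n)))
  where open import Data.Nat.Combinatorics using (_C_)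

IsIntegral : ℚ → Set
IsIntegral q = ↧ₙ q ≡ 1

IntegralPoly : Poly → Set
IntegralPoly f = ∀ i → IsIntegral (coeff f i)

IsDenomP : ℕ → Poly → Set
IsDenomP d f = (1 ℕ.≤ d) × IntegralPoly (scaleP (ℕtoℚ d) f)
             × (∀ d′ → 1 ℕ.≤ d′ → IntegralPoly (scaleP (ℕtoℚ d′) f) → d ℕ.≤ d′)

-- Every operation in the statement is linear in the coefficients, so a polynomial p is handled
-- through the functional ⟪ p ⟫ f = Σᵢ pᵢ f(i): the coefficients, the values and ∫₀¹ of p are ⟪ p ⟫ at
-- f = δ i, f = x ^Q_ and f = 1/(1+_), and sums, products, composition and derivatives of polynomials
-- become manipulations of finite sums. Then (i) and (iii) hold term by term, by C(n,k) k! = (n)ₖ and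
-- (n+1-k) C(n+1,k) = (n+1) C(n,k); (iv) follows from expanding (x+y)ᵐ and C(n,k) C(n-k,i) =
-- C(n,i+k) C(i+k,k); (ii) from the Beta integral r ∫₀¹ tᵏ (1-t)^(r-1) dt = 1/C(r+k,r), proved by
-- induction on r. For (v) and (vi), C(r+n,r) C(n,k) / C(r+k,r) = C(r+n,n-k) is an integer, while the
-- constant term (-1)ⁿ/C(r+n,r) shows that no smaller multiplier clears all denominators.

module Submission where

open import Data.Bool using (if_then_else_)
open import Data.Integer as ℤ using (ℤ)
import Data.Integer.Properties as ℤP
open import Data.List using ([]; _∷_; map; upTo; applyUpTo)
import Data.List.Properties as ListP
open import Data.Nat as ℕ using (ℕ; zero; suc; z≤n; s≤s; _∸_; _!; _≤_; _<_)
import Data.Nat.Properties as ℕP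
open import Data.Nat.Properties using (_!≢0; _!*_!≢0)
open import Data.Nat.Combinatorics
  using (_C_; k>n⇒nCk≡0; nCk≡n!/k![n-k]!; k![n∸k]!∣n!; nCk≡nC[n∸k]; nCk+nC[k+1]≡[n+1]C[k+1]; nCn≡1)
open import Data.Nat.Divisibility using (_∣_; divides; ∣⇒≤)
open import Data.Nat.DivMod using (m/n*n≡m)
open import Data.Nat.GCD using (gcd)
open import Data.Product using (_×_; ∃-syntax; _,_)
open import Data.Sum using (_⊎_; inj₁; inj₂)
open import Function using (_∘_; id)
open import Relation.Binary.PropositionalEquality
open import Relation.Nullary using (contradiction)
open import Defs

-- Binomial coefficients and factorials

module Binomial where

  open import Data.Nat.Solver using (module +-*-Solver)
  open +-*-Solver
  open import Data.Nat using (_+_; _*_)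
  open ≡-Reasoning

  n!≢0 : ∀ n → n ! ≢ 0
  n!≢0 n = ℕ.≢-nonZero⁻¹ (n !) {{n !≢0}}

  nCk*[k!*j!]≡n! : ∀ {n k j} → k ≤ n → n ∸ k ≡ j → (n C k) * (k ! * j !) ≡ n !
  nCk*[k!*j!]≡n! {n} {k} k≤n refl =
    trans (cong (_* (k ! * (n ∸ k) !)) (nCk≡n!/k![n-k]! k≤n))
          (m/n*n≡m {{k !* (n ∸ k) !≢0}} (k![n∸k]!∣n! k≤n))

  nCk≢0 : ∀ {n k} → k ≤ n → (n C k) ≢ 0
  nCk≢0 {n} {k} k≤n nCk≡0 = n!≢0 n (begin
    n !                            ≡⟨ nCk*[k!*j!]≡n! k≤n refl ⟨
    (n C k) * (k ! * (n ∸ k) !)    ≡⟨ cong (_* (k ! * (n ∸ k) !)) nCk≡0 ⟩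
    0                              ∎)

  ff*[n∸k]!≡n! : ∀ {n k} → k ≤ n → ff n k * (n ∸ k) ! ≡ n !
  ff*[n∸k]!≡n! {n} {zero} _ = ℕP.*-identityˡ (n !)
  ff*[n∸k]!≡n! {suc n} {suc k} (s≤s k≤n) =
    trans (ℕP.*-assoc (suc n) (ff n k) ((n ∸ k) !)) (cong (suc n *_) (ff*[n∸k]!≡n! k≤n))

  ff≡0 : ∀ {n k} → n < k → ff n k ≡ 0
  ff≡0 {zero}  {suc k} _         = refl
  ff≡0 {suc n} {suc k} (s≤s n<k) = trans (cong (suc n *_) (ff≡0 n<k)) (ℕP.*-zeroʳ (suc n))

  nCk*k!≡ff : ∀ n k → (n C k) * k ! ≡ ff n k
  nCk*k!≡ff n k with ℕP.≤-<-connex k n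
  ... | inj₁ k≤n = ℕP.*-cancelʳ-≡ _ _ ((n ∸ k) !) {{(n ∸ k) !≢0}} (begin
    (n C k) * k ! * (n ∸ k) !       ≡⟨ ℕP.*-assoc (n C k) (k !) _ ⟩
    (n C k) * (k ! * (n ∸ k) !)     ≡⟨ nCk*[k!*j!]≡n! k≤n refl ⟩
    n !                           ≡⟨ ff*[n∸k]!≡n! k≤n ⟨
    ff n k * (n ∸ k) !            ∎)
  ... | inj₂ n<k = trans (cong (_* k !) (k>n⇒nCk≡0 n<k)) (sym (ff≡0 n<k))

  [r+k]Cr*k!≡ff : ∀ r k → ((r + k) C r) * k ! ≡ ff (r + k) k
  [r+k]Cr*k!≡ff r k = trans (cong (_* k !) [r+k]Cr≡[r+k]Ck) (nCk*k!≡ff (r + k) k)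
    where
    [r+k]Cr≡[r+k]Ck : (r + k) C r ≡ (r + k) C k
    [r+k]Cr≡[r+k]Ck = trans (nCk≡nC[n∸k] (ℕP.m≤m+n r k)) (cong ((r + k) C_) (ℕP.m+n∸m≡n r k))

  [1+m∸k]*[1+m]Ck≡[1+m]*mCk : ∀ {m k} → k ≤ m → (suc m ∸ k) * (suc m C k) ≡ suc m * (m C k)
  [1+m∸k]*[1+m]Ck≡[1+m]*mCk {m} {k} k≤m =
    ℕP.*-cancelʳ-≡ _ _ (k ! * (m ∸ k) !) {{k !* (m ∸ k) !≢0}} (begin
      (suc m ∸ k) * (suc m C k) * (k ! * (m ∸ k) !)
        ≡⟨ cong (λ t → t * (suc m C k) * (k ! * (m ∸ k) !)) 1+m∸k≡1+[m∸k] ⟩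
      suc (m ∸ k) * (suc m C k) * (k ! * (m ∸ k) !)
        ≡⟨ solve 4 (λ s c a b → s :* c :* (a :* b) := c :* (a :* (s :* b))) refl
                   (suc (m ∸ k)) (suc m C k) (k !) ((m ∸ k) !) ⟩
      (suc m C k) * (k ! * (suc (m ∸ k)) !)
        ≡⟨ nCk*[k!*j!]≡n! (ℕP.m≤n⇒m≤1+n k≤m) 1+m∸k≡1+[m∸k] ⟩
      suc m !
        ≡⟨ cong (suc m *_) (nCk*[k!*j!]≡n! k≤m refl) ⟨
      suc m * ((m C k) * (k ! * (m ∸ k) !))
        ≡⟨ ℕP.*-assoc (suc m) (m C k) _ ⟨
      suc m * (m C k) * (k ! * (m ∸ k) !) ∎)
    where
    1+m∸k≡1+[m∸k] : suc m ∸ k ≡ suc (m ∸ k)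
    1+m∸k≡1+[m∸k] = ℕP.+-∸-assoc 1 k≤m

  private
    *-cancelʳ-!*!*! : ∀ a b i j l → a * (i ! * j ! * l !) ≡ b * (i ! * j ! * l !) → a ≡ b
    *-cancelʳ-!*!*! a b i j l = ℕP.*-cancelʳ-≡ a b _ {{ℕP.m*n≢0 _ _ {{i !* j !≢0}} {{l !≢0}}}}

  nCk*[n∸k]Ci≡nC[i+k]*[i+k]Ck : ∀ {n k i} → i + k ≤ n →
    (n C k) * ((n ∸ k) C i) ≡ (n C (i + k)) * ((i + k) C k)
  nCk*[n∸k]Ci≡nC[i+k]*[i+k]Ck {n} {k} {i} i+k≤n = *-cancelʳ-!*!*! _ _ k i l (begin
    (n C k) * ((n ∸ k) C i) * (k ! * i ! * l !)
      ≡⟨ solve 5 (λ c d a b e → c :* d :* (a :* b :* e) := c :* (a :* (d :* (b :* e)))) refl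
                 (n C k) ((n ∸ k) C i) (k !) (i !) (l !) ⟩
    (n C k) * (k ! * (((n ∸ k) C i) * (i ! * l !)))
      ≡⟨ cong (λ t → (n C k) * (k ! * t)) (nCk*[k!*j!]≡n! i≤n∸k n∸k∸i≡l) ⟩
    (n C k) * (k ! * (n ∸ k) !)
      ≡⟨ nCk*[k!*j!]≡n! k≤n refl ⟩
    n !
      ≡⟨ nCk*[k!*j!]≡n! i+k≤n refl ⟨
    (n C (i + k)) * ((i + k) ! * l !)
      ≡⟨ cong (λ t → (n C (i + k)) * (t * l !)) (nCk*[k!*j!]≡n! (ℕP.m≤n+m k i) (ℕP.m+n∸n≡m i k)) ⟨
    (n C (i + k)) * (((i + k) C k) * (k ! * i !) * l !)
      ≡⟨ solve 5 (λ c d a b e → c :* (d :* (a :* b) :* e) := c :* d :* (a :* b :* e)) refl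
                 (n C (i + k)) ((i + k) C k) (k !) (i !) (l !) ⟩
    (n C (i + k)) * ((i + k) C k) * (k ! * i ! * l !) ∎)
    where
    l = n ∸ (i + k)
    k≤n : k ≤ n
    k≤n = ℕP.≤-trans (ℕP.m≤n+m k i) i+k≤n
    i≤n∸k : i ≤ n ∸ k
    i≤n∸k = subst (_≤ n ∸ k) (ℕP.m+n∸n≡m i k) (ℕP.∸-monoˡ-≤ k i+k≤n)
    n∸k∸i≡l : n ∸ k ∸ i ≡ l
    n∸k∸i≡l = trans (ℕP.∸-+-assoc n k i) (cong (n ∸_) (ℕP.+-comm k i))

  [r+n]Cr*nCk≡[r+n]C[n∸k]*[r+k]Cr : ∀ r {n k} → k ≤ n →
    ((r + n) C r) * (n C k) ≡ ((r + n) C (n ∸ k)) * ((r + k) C r)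
  [r+n]Cr*nCk≡[r+n]C[n∸k]*[r+k]Cr r {n} {k} k≤n = *-cancelʳ-!*!*! _ _ r k (n ∸ k) (begin
    ((r + n) C r) * (n C k) * (r ! * k ! * (n ∸ k) !)
      ≡⟨ solve 5 (λ c d a b e → c :* d :* (a :* b :* e) := c :* (a :* (d :* (b :* e)))) refl
                 ((r + n) C r) (n C k) (r !) (k !) ((n ∸ k) !) ⟩
    ((r + n) C r) * (r ! * ((n C k) * (k ! * (n ∸ k) !)))
      ≡⟨ cong (λ t → ((r + n) C r) * (r ! * t)) (nCk*[k!*j!]≡n! k≤n refl) ⟩
    ((r + n) C r) * (r ! * n !)
      ≡⟨ nCk*[k!*j!]≡n! (ℕP.m≤m+n r n) (ℕP.m+n∸m≡n r n) ⟩
    (r + n) !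
      ≡⟨ nCk*[k!*j!]≡n! n∸k≤r+n r+n∸[n∸k]≡r+k ⟨
    ((r + n) C (n ∸ k)) * ((n ∸ k) ! * (r + k) !)
      ≡⟨ cong (λ t → ((r + n) C (n ∸ k)) * ((n ∸ k) ! * t)) (nCk*[k!*j!]≡n! (ℕP.m≤m+n r k) (ℕP.m+n∸m≡n r k)) ⟨
    ((r + n) C (n ∸ k)) * ((n ∸ k) ! * (((r + k) C r) * (r ! * k !)))
      ≡⟨ solve 5 (λ c d a b e → c :* (e :* (d :* (a :* b))) := c :* d :* (a :* b :* e)) refl
                 ((r + n) C (n ∸ k)) ((r + k) C r) (r !) (k !) ((n ∸ k) !) ⟩
    ((r + n) C (n ∸ k)) * ((r + k) C r) * (r ! * k ! * (n ∸ k) !) ∎)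
    where
    n∸k≤r+n : n ∸ k ≤ r + n
    n∸k≤r+n = ℕP.≤-trans (ℕP.m∸n≤m n k) (ℕP.m≤n+m n r)
    r+n∸[n∸k]≡r+k : r + n ∸ (n ∸ k) ≡ r + k
    r+n∸[n∸k]≡r+k = trans (ℕP.+-∸-assoc r (ℕP.m∸n≤m n k)) (cong (r +_) (ℕP.m∸[m∸n]≡n k≤n))

  k!*R!*[2+k+R]≡[1+k]!*R!+k!*[1+R]! : ∀ k R →
    k ! * R ! * suc (suc (k + R)) ≡ (suc k) ! * R ! + k ! * (suc R) !
  k!*R!*[2+k+R]≡[1+k]!*R!+k!*[1+R]! k R =
    solve 4 (λ k R f g → f :* g :* (con 2 :+ k :+ R) := (con 1 :+ k) :* f :* g :+ f :* ((con 1 :+ R) :* g))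
          refl k R (k !) (R !)

  [1+R]*[k!*R!]*[1+R+k]C[1+R]≡[1+k+R]! : ∀ R k →
    suc R * (k ! * R !) * ((suc R + k) C suc R) ≡ (suc (k + R)) !
  [1+R]*[k!*R!]*[1+R+k]C[1+R]≡[1+k+R]! R k = begin
    suc R * (k ! * R !) * D
      ≡⟨ solve 4 (λ r a b d → (con 1 :+ r) :* (a :* b) :* d := d :* ((con 1 :+ r) :* b :* a)) refl R (k !) (R !) D ⟩
    D * ((suc R) ! * k !)
      ≡⟨ nCk*[k!*j!]≡n! (ℕP.m≤m+n (suc R) k) (ℕP.m+n∸m≡n (suc R) k) ⟩
    (suc R + k) !
      ≡⟨ cong (λ t → (suc t) !) (ℕP.+-comm R k) ⟩
    (suc (k + R)) ! ∎
    where D = (suc R + k) C suc R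

open Binomial

open import Data.Rational using (ℚ; mkℚ; _/_; 0ℚ; 1ℚ; _+_; _*_; -_; ↧ₙ_; toℚᵘ)
import Data.Rational.Properties as ℚP
import Data.Rational.Solver as ℚSolver
import Data.Rational.Unnormalised as ℚᵘ
import Data.Rational.Unnormalised.Properties as ℚᵘP

open ℚSolver.+-*-Solver

fromℤ : ℤ → ℚ
fromℤ z = z / 1

toℚᵘ-/ : ∀ z d → toℚᵘ (z / suc d) ℚᵘ.≃ ℚᵘ.mkℚᵘ z d
toℚᵘ-/ z d = ℚP.toℚᵘ-fromℚᵘ (ℚᵘ.mkℚᵘ z d)

fromℤ-+ : ∀ z w → fromℤ (z ℤ.+ w) ≡ fromℤ z + fromℤ w
fromℤ-+ z w = ℚP.toℚᵘ-injective (ℚᵘP.≃-trans (toℚᵘ-/ (z ℤ.+ w) 0)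
  (ℚᵘP.≃-trans (ℚᵘ.*≡* cross) (ℚᵘP.≃-sym (ℚᵘP.≃-trans (ℚP.toℚᵘ-homo-+ (fromℤ z) (fromℤ w))
    (ℚᵘP.+-cong (toℚᵘ-/ z 0) (toℚᵘ-/ w 0))))))
  where
  cross : (z ℤ.+ w) ℤ.* (ℤ.+ 1 ℤ.* ℤ.+ 1) ≡ (z ℤ.* ℤ.+ 1 ℤ.+ w ℤ.* ℤ.+ 1) ℤ.* ℤ.+ 1
  cross = trans (ℤP.*-identityʳ _)
    (sym (trans (ℤP.*-identityʳ _) (cong₂ ℤ._+_ (ℤP.*-identityʳ z) (ℤP.*-identityʳ w))))

fromℤ-* : ∀ z w → fromℤ (z ℤ.* w) ≡ fromℤ z * fromℤ w
fromℤ-* z w = ℚP.toℚᵘ-injective (ℚᵘP.≃-trans (toℚᵘ-/ (z ℤ.* w) 0)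
  (ℚᵘP.≃-trans (ℚᵘ.*≡* refl) (ℚᵘP.≃-sym (ℚᵘP.≃-trans (ℚP.toℚᵘ-homo-* (fromℤ z) (fromℤ w))
    (ℚᵘP.*-cong (toℚᵘ-/ z 0) (toℚᵘ-/ w 0))))))

fromℤ-neg : ∀ z → fromℤ (ℤ.- z) ≡ - fromℤ z
fromℤ-neg z = ℚP.toℚᵘ-injective (ℚᵘP.≃-trans (toℚᵘ-/ (ℤ.- z) 0)
  (ℚᵘP.≃-sym (ℚᵘP.≃-trans (ℚP.toℚᵘ-homo‿- (fromℤ z)) (ℚᵘP.-‿cong (toℚᵘ-/ z 0)))))

fromℤ-injective : ∀ z w → fromℤ z ≡ fromℤ w → z ≡ w
fromℤ-injective z w eq
  with ℚᵘP.≃-trans (ℚᵘP.≃-sym (toℚᵘ-/ z 0)) (ℚᵘP.≃-trans (ℚᵘP.≃-reflexive (cong toℚᵘ eq)) (toℚᵘ-/ w 0))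
... | ℚᵘ.*≡* cross = trans (sym (ℤP.*-identityʳ z)) (trans cross (ℤP.*-identityʳ w))

ℕtoℚ-+ : ∀ a b → ℕtoℚ (a ℕ.+ b) ≡ ℕtoℚ a + ℕtoℚ b
ℕtoℚ-+ a b = trans (cong fromℤ (ℤP.pos-+ a b)) (fromℤ-+ (ℤ.+ a) (ℤ.+ b))

ℕtoℚ-* : ∀ a b → ℕtoℚ (a ℕ.* b) ≡ ℕtoℚ a * ℕtoℚ b
ℕtoℚ-* a b = trans (cong fromℤ (ℤP.pos-* a b)) (fromℤ-* (ℤ.+ a) (ℤ.+ b))

fromℤ*invℕ≡/ : ∀ z d → fromℤ z * invℕ (suc d) ≡ z / suc d
fromℤ*invℕ≡/ z d = ℚP.toℚᵘ-injective (ℚᵘP.≃-trans (ℚP.toℚᵘ-homo-* (fromℤ z) (invℕ (suc d)))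
  (ℚᵘP.≃-trans (ℚᵘP.*-cong (toℚᵘ-/ z 0) (toℚᵘ-/ (ℤ.+ 1) d)) (ℚᵘP.≃-trans (ℚᵘ.*≡* cross) (ℚᵘP.≃-sym (toℚᵘ-/ z d)))))
  where
  cross : (z ℤ.* ℤ.+ 1) ℤ.* ℤ.+ suc d ≡ z ℤ.* (ℤ.+ 1 ℤ.* ℤ.+ suc d)
  cross = trans (cong (ℤ._* ℤ.+ suc d) (ℤP.*-identityʳ z)) (cong (z ℤ.*_) (sym (ℤP.*-identityˡ (ℤ.+ suc d))))

ℕtoℚ*invℕ≡1 : ∀ {m} → m ≢ 0 → ℕtoℚ m * invℕ m ≡ 1ℚ
ℕtoℚ*invℕ≡1 {zero}  m≢0 = contradiction refl m≢0
ℕtoℚ*invℕ≡1 {suc m} _   = ℚP.toℚᵘ-injective (ℚᵘP.≃-trans (ℚP.toℚᵘ-homo-* (ℕtoℚ (suc m)) (invℕ (suc m)))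
  (ℚᵘP.≃-trans (ℚᵘP.*-cong (toℚᵘ-/ (ℤ.+ suc m) 0) (toℚᵘ-/ (ℤ.+ 1) m)) (ℚᵘ.*≡* cross)))
  where
  cross : (ℤ.+ suc m ℤ.* ℤ.+ 1) ℤ.* ℤ.+ 1 ≡ ℤ.+ 1 ℤ.* (ℤ.+ 1 ℤ.* ℤ.+ suc m)
  cross = trans (ℤP.*-identityʳ (ℤ.+ suc m ℤ.* ℤ.+ 1))
    (trans (ℤP.*-identityʳ (ℤ.+ suc m)) (sym (trans (ℤP.*-identityˡ (ℤ.+ 1 ℤ.* ℤ.+ suc m)) (ℤP.*-identityˡ (ℤ.+ suc m)))))

a/b≡c/d : ∀ a b c d → b ≢ 0 → d ≢ 0 → a ℕ.* d ≡ c ℕ.* b → ℕtoℚ a * invℕ b ≡ ℕtoℚ c * invℕ d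
a/b≡c/d a b c d b≢0 d≢0 ad≡cb = begin
  A * B⁻¹                   ≡⟨ ℚP.*-identityʳ _ ⟨
  A * B⁻¹ * 1ℚ              ≡⟨ cong (A * B⁻¹ *_) (ℕtoℚ*invℕ≡1 d≢0) ⟨
  A * B⁻¹ * (D * D⁻¹)       ≡⟨ solve 4 (λ A B⁻¹ D D⁻¹ → A :* B⁻¹ :* (D :* D⁻¹) := (A :* D) :* B⁻¹ :* D⁻¹) refl A B⁻¹ D D⁻¹ ⟩
  (A * D) * B⁻¹ * D⁻¹       ≡⟨ cong (λ t → t * B⁻¹ * D⁻¹) (trans (sym (ℕtoℚ-* a d)) (trans (cong ℕtoℚ ad≡cb) (ℕtoℚ-* c b))) ⟩
  (C′ * B) * B⁻¹ * D⁻¹      ≡⟨ solve 4 (λ C′ B B⁻¹ D⁻¹ → (C′ :* B) :* B⁻¹ :* D⁻¹ := C′ :* D⁻¹ :* (B :* B⁻¹)) refl C′ B B⁻¹ D⁻¹ ⟩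
  C′ * D⁻¹ * (B * B⁻¹)      ≡⟨ cong (C′ * D⁻¹ *_) (ℕtoℚ*invℕ≡1 b≢0) ⟩
  C′ * D⁻¹ * 1ℚ             ≡⟨ ℚP.*-identityʳ _ ⟩
  C′ * D⁻¹                  ∎
  where
  open ≡-Reasoning
  A = ℕtoℚ a ; B = ℕtoℚ b ; C′ = ℕtoℚ c ; D = ℕtoℚ d ; B⁻¹ = invℕ b ; D⁻¹ = invℕ d

-1^k*-1^k≡1 : ∀ k → (- 1ℚ) ^Q k * (- 1ℚ) ^Q k ≡ 1ℚ
-1^k*-1^k≡1 zero    = refl
-1^k*-1^k≡1 (suc k) = trans
  (solve 2 (λ m s → (m :* s) :* (m :* s) := (m :* m) :* (s :* s)) refl (- 1ℚ) ((- 1ℚ) ^Q k))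
  (cong ((- 1ℚ) * (- 1ℚ) *_) (-1^k*-1^k≡1 k))

1^k≡1 : ∀ k → 1ℚ ^Q k ≡ 1ℚ
1^k≡1 zero    = refl
1^k≡1 (suc k) = trans (ℚP.*-identityˡ _) (1^k≡1 k)

-- A witnessed form of IsIntegral, closed under + and * by construction.
IsFromℤ : ℚ → Set
IsFromℤ q = ∃[ z ] q ≡ fromℤ z

IsFromℤ-+ : ∀ {p q} → IsFromℤ p → IsFromℤ q → IsFromℤ (p + q)
IsFromℤ-+ (z , refl) (w , refl) = z ℤ.+ w , sym (fromℤ-+ z w)

IsFromℤ-* : ∀ {p q} → IsFromℤ p → IsFromℤ q → IsFromℤ (p * q)
IsFromℤ-* (z , refl) (w , refl) = z ℤ.* w , sym (fromℤ-* z w)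

IsFromℤ-^ : ∀ {q} k → IsFromℤ q → IsFromℤ (q ^Q k)
IsFromℤ-^ zero    _ = ℤ.+ 1 , refl
IsFromℤ-^ (suc k) q = IsFromℤ-* q (IsFromℤ-^ k q)

IsFromℤ-sign : ∀ k → IsFromℤ ((- 1ℚ) ^Q k)
IsFromℤ-sign k = IsFromℤ-^ k (ℤ.- ℤ.+ 1 , sym (fromℤ-neg (ℤ.+ 1)))

IsFromℤ⇒IsIntegral : ∀ {q} → IsFromℤ q → IsIntegral q
IsFromℤ⇒IsIntegral (z , refl) =
  ℕP.m*n≡1⇒m≡1 _ _ (ℤP.+-injective (trans (ℤP.pos-* (↧ₙ fromℤ z) _) (ℚP.↧-/ z 1)))

IsIntegral⇒IsFromℤ : ∀ {q} → IsIntegral q → IsFromℤ q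
IsIntegral⇒IsFromℤ {q@(mkℚ z zero _)} refl = z , sym (ℚP.↥p/↧p≡p q)

-- ℚP.↧-/ : the reduced denominator of z / d times gcd(|z|, d) is d.
↧ₙ[fromℤ*invℕ]∣ : ∀ z d → ↧ₙ (fromℤ z * invℕ (suc d)) ∣ suc d
↧ₙ[fromℤ*invℕ]∣ z d rewrite fromℤ*invℕ≡/ z d =
  divides g (sym (trans (ℕP.*-comm g (↧ₙ (z / suc d)))
    (ℤP.+-injective (trans (ℤP.pos-* (↧ₙ (z / suc d)) g) (ℚP.↧-/ z (suc d))))))
  where g = gcd ℤ.∣ z ∣ (suc d)

IsFromℤ-*⇒↧ₙ∣ : ∀ {D} q → D ≢ 0 → IsFromℤ (ℕtoℚ D * q) → ↧ₙ q ∣ D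
IsFromℤ-*⇒↧ₙ∣ {zero}  q D≢0 _            = contradiction refl D≢0
IsFromℤ-*⇒↧ₙ∣ {suc D} q _   (z , Dq≡z) = subst (λ t → ↧ₙ t ∣ suc D) (sym q≡z/D) (↧ₙ[fromℤ*invℕ]∣ z D)
  where
  q≡z/D : q ≡ fromℤ z * invℕ (suc D)
  q≡z/D = begin
    q                                 ≡⟨ ℚP.*-identityʳ q ⟨
    q * 1ℚ                            ≡⟨ cong (q *_) (ℕtoℚ*invℕ≡1 {suc D} (λ ())) ⟨
    q * (ℕtoℚ (suc D) * invℕ (suc D)) ≡⟨ solve 3 (λ q a b → q :* (a :* b) := (a :* q) :* b) refl q (ℕtoℚ (suc D)) (invℕ (suc D)) ⟩
    ℕtoℚ (suc D) * q * invℕ (suc D)   ≡⟨ cong (_* invℕ (suc D)) Dq≡z ⟩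
    fromℤ z * invℕ (suc D)            ∎
    where open ≡-Reasoning

-- Finite sums

∑ : ℕ → (ℕ → ℚ) → ℚ
∑ zero    f = 0ℚ
∑ (suc n) f = f 0 + ∑ n (f ∘ suc)

∑-cong : ∀ n {f g : ℕ → ℚ} → (∀ {k} → k < n → f k ≡ g k) → ∑ n f ≡ ∑ n g
∑-cong zero    _   = refl
∑-cong (suc n) f≗g = cong₂ _+_ (f≗g (s≤s z≤n)) (∑-cong n (f≗g ∘ s≤s))

∑-zero : ∀ n {f : ℕ → ℚ} → (∀ {k} → k < n → f k ≡ 0ℚ) → ∑ n f ≡ 0ℚ
∑-zero zero    _    = refl
∑-zero (suc n) f≗0 = cong₂ _+_ (f≗0 (s≤s z≤n)) (∑-zero n (f≗0 ∘ s≤s))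

∑-+ : ∀ n (f g : ℕ → ℚ) → ∑ n (λ k → f k + g k) ≡ ∑ n f + ∑ n g
∑-+ zero    f g = refl
∑-+ (suc n) f g = trans (cong (f 0 + g 0 +_) (∑-+ n (f ∘ suc) (g ∘ suc)))
  (solve 4 (λ a b c d → (a :+ b) :+ (c :+ d) := (a :+ c) :+ (b :+ d)) refl
         (f 0) (g 0) (∑ n (f ∘ suc)) (∑ n (g ∘ suc)))

∑-*ˡ : ∀ n c (f : ℕ → ℚ) → ∑ n (λ k → c * f k) ≡ c * ∑ n f
∑-*ˡ zero    c f = sym (ℚP.*-zeroʳ c)
∑-*ˡ (suc n) c f = trans (cong (c * f 0 +_) (∑-*ˡ n c (f ∘ suc))) (sym (ℚP.*-distribˡ-+ c (f 0) _))

∑-suc : ∀ n (f : ℕ → ℚ) → ∑ (suc n) f ≡ ∑ n f + f n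
∑-suc zero    f = trans (ℚP.+-identityʳ (f 0)) (sym (ℚP.+-identityˡ (f 0)))
∑-suc (suc n) f = trans (cong (f 0 +_) (∑-suc n (f ∘ suc))) (sym (ℚP.+-assoc (f 0) _ _))

∑-split : ∀ m n (f : ℕ → ℚ) → ∑ (m ℕ.+ n) f ≡ ∑ m f + ∑ n (λ k → f (m ℕ.+ k))
∑-split zero    n f = sym (ℚP.+-identityˡ _)
∑-split (suc m) n f = trans (cong (f 0 +_) (∑-split m n (f ∘ suc))) (sym (ℚP.+-assoc (f 0) _ _))

∑-reverse : ∀ n (f : ℕ → ℚ) → ∑ (suc n) f ≡ ∑ (suc n) (λ k → f (n ∸ k))
∑-reverse zero    f = refl
∑-reverse (suc n) f = begin
  f 0 + ∑ (suc n) (f ∘ suc)                ≡⟨ cong (f 0 +_) (∑-reverse n (f ∘ suc)) ⟩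
  f 0 + ∑ (suc n) (λ k → f (suc (n ∸ k)))  ≡⟨ cong (f 0 +_) (∑-cong (suc n) (cong f ∘ sym ∘ ℕP.+-∸-assoc 1 ∘ ℕP.≤-pred)) ⟩
  f 0 + ∑ (suc n) g                        ≡⟨ ℚP.+-comm (f 0) _ ⟩
  ∑ (suc n) g + f 0                        ≡⟨ cong (λ k → ∑ (suc n) g + f k) (ℕP.n∸n≡0 (suc n)) ⟨
  ∑ (suc n) g + g (suc n)                  ≡⟨ ∑-suc (suc n) g ⟨
  ∑ (suc (suc n)) g                        ∎
  where
  open ≡-Reasoning
  g = λ k → f (suc n ∸ k)

∑-pascal : ∀ m (f : ℕ → ℚ) → ∑ (suc (suc m)) (λ k → ℕtoℚ (suc m C k) * f k)
         ≡ ∑ (suc m) (λ k → ℕtoℚ (m C k) * f k) + ∑ (suc m) (λ k → ℕtoℚ (m C k) * f (suc k))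
∑-pascal m f = begin
  ℕtoℚ 1 * f 0 + ∑ (suc m) (λ k → ℕtoℚ (suc m C suc k) * f (suc k))
    ≡⟨ cong₂ _+_ (ℚP.*-identityˡ (f 0)) (∑-cong (suc m) (λ {k} _ → split k)) ⟩
  f 0 + ∑ (suc m) (λ k → ℕtoℚ (m C k) * f (suc k) + ℕtoℚ (m C suc k) * f (suc k))
    ≡⟨ cong (f 0 +_) (∑-+ (suc m) (λ k → ℕtoℚ (m C k) * f (suc k)) (λ k → ℕtoℚ (m C suc k) * f (suc k))) ⟩
  f 0 + (X + ∑ (suc m) (λ k → ℕtoℚ (m C suc k) * f (suc k)))
    ≡⟨ cong (λ t → f 0 + (X + t)) (∑-suc m _) ⟩
  f 0 + (X + (Y + ℕtoℚ (m C suc m) * f (suc m)))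
    ≡⟨ cong (λ c → f 0 + (X + (Y + ℕtoℚ c * f (suc m)))) (k>n⇒nCk≡0 (ℕP.n<1+n m)) ⟩
  f 0 + (X + (Y + 0ℚ * f (suc m)))
    ≡⟨ solve 4 (λ a x y b → a :+ (x :+ (y :+ con 0ℚ :* b)) := (con 1ℚ :* a :+ y) :+ x) refl (f 0) X Y (f (suc m)) ⟩
  (1ℚ * f 0 + Y) + X ∎
  where
  open ≡-Reasoning
  X = ∑ (suc m) (λ k → ℕtoℚ (m C k) * f (suc k))
  Y = ∑ m (λ k → ℕtoℚ (m C suc k) * f (suc k))
  split : ∀ k → ℕtoℚ (suc m C suc k) * f (suc k) ≡ ℕtoℚ (m C k) * f (suc k) + ℕtoℚ (m C suc k) * f (suc k)
  split k = trans (cong (λ c → ℕtoℚ c * f (suc k)) (sym (nCk+nC[k+1]≡[n+1]C[k+1] m k)))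
    (trans (cong (_* f (suc k)) (ℕtoℚ-+ (m C k) (m C suc k))) (ℚP.*-distribʳ-+ (f (suc k)) (ℕtoℚ (m C k)) (ℕtoℚ (m C suc k))))

δ : ℕ → ℕ → ℚ
δ i k = if k ℕ.≡ᵇ i then 1ℚ else 0ℚ

∑-δ : ∀ n i (f : ℕ → ℚ) → i < n → ∑ n (λ k → f k * δ i k) ≡ f i
∑-δ (suc n) zero    f _ = trans (cong₂ _+_ (ℚP.*-identityʳ (f 0)) (∑-zero n (λ {k} _ → ℚP.*-zeroʳ (f (suc k)))))
  (ℚP.+-identityʳ (f 0))
∑-δ (suc n) (suc i) f (s≤s i<n) = trans (cong₂ _+_ (ℚP.*-zeroʳ (f 0)) (∑-δ n i (f ∘ suc) i<n)) (ℚP.+-identityˡ _)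

∑-δ-out : ∀ n i (f : ℕ → ℚ) → n ≤ i → ∑ n (λ k → f k * δ i k) ≡ 0ℚ
∑-δ-out zero    i       f _         = refl
∑-δ-out (suc n) (suc i) f (s≤s n≤i) = trans (cong₂ _+_ (ℚP.*-zeroʳ (f 0)) (∑-δ-out n i (f ∘ suc) n≤i))
  (ℚP.+-identityˡ _)

IsFromℤ-∑ : ∀ n (f : ℕ → ℚ) → (∀ {k} → k < n → IsFromℤ (f k)) → IsFromℤ (∑ n f)
IsFromℤ-∑ zero    f _        = ℤ.+ 0 , refl
IsFromℤ-∑ (suc n) f f-integral = IsFromℤ-+ (f-integral (s≤s z≤n)) (IsFromℤ-∑ n (f ∘ suc) (f-integral ∘ s≤s))

∑-shift : ∀ m i (f g : ℕ → ℚ) →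
  (∀ {k} → k < i → f (suc m ℕ.+ k) ≡ 0ℚ) → (∀ {k} → k < i → g k ≡ 0ℚ) →
  (∀ {k} → k < suc m → f k ≡ g (i ℕ.+ k)) →
  ∑ (suc m ℕ.+ i) f ≡ ∑ (i ℕ.+ suc m) g
∑-shift m i f g f-tail≡0 g-head≡0 f≗g = begin
  ∑ (suc m ℕ.+ i) f                                ≡⟨ ∑-split (suc m) i f ⟩
  ∑ (suc m) f + ∑ i (λ k → f (suc m ℕ.+ k))        ≡⟨ cong (∑ (suc m) f +_) (∑-zero i f-tail≡0) ⟩
  ∑ (suc m) f + 0ℚ                                 ≡⟨ ℚP.+-identityʳ _ ⟩
  ∑ (suc m) f                                      ≡⟨ ∑-cong (suc m) f≗g ⟩
  ∑ (suc m) (λ k → g (i ℕ.+ k))                    ≡⟨ ℚP.+-identityˡ _ ⟨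
  0ℚ + ∑ (suc m) (λ k → g (i ℕ.+ k))               ≡⟨ cong (_+ ∑ (suc m) (λ k → g (i ℕ.+ k))) (∑-zero i g-head≡0) ⟨
  ∑ i g + ∑ (suc m) (λ k → g (i ℕ.+ k))            ≡⟨ ∑-split i (suc m) g ⟨
  ∑ (i ℕ.+ suc m) g                                ∎
  where open ≡-Reasoning

-- Polynomials as functionals on sequences

⟪_⟫ : Poly → (ℕ → ℚ) → ℚ
⟪ []    ⟫ f = 0ℚ
⟪ a ∷ p ⟫ f = a * f 0 + ⟪ p ⟫ (f ∘ suc)

⟪⟫-cong : ∀ p {f g : ℕ → ℚ} → (∀ k → f k ≡ g k) → ⟪ p ⟫ f ≡ ⟪ p ⟫ g
⟪⟫-cong []      f≗g = refl
⟪⟫-cong (a ∷ p) f≗g = cong₂ _+_ (cong (a *_) (f≗g 0)) (⟪⟫-cong p (f≗g ∘ suc))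

⟪⟫-zero : ∀ p → ⟪ p ⟫ (λ _ → 0ℚ) ≡ 0ℚ
⟪⟫-zero []      = refl
⟪⟫-zero (a ∷ p) = cong₂ _+_ (ℚP.*-zeroʳ a) (⟪⟫-zero p)

⟪⟫-+ : ∀ p (f g : ℕ → ℚ) → ⟪ p ⟫ (λ k → f k + g k) ≡ ⟪ p ⟫ f + ⟪ p ⟫ g
⟪⟫-+ []      f g = refl
⟪⟫-+ (a ∷ p) f g = trans (cong (a * (f 0 + g 0) +_) (⟪⟫-+ p (f ∘ suc) (g ∘ suc)))
  (solve 5 (λ a x y u v → a :* (x :+ y) :+ (u :+ v) := (a :* x :+ u) :+ (a :* y :+ v)) refl
         a (f 0) (g 0) (⟪ p ⟫ (f ∘ suc)) (⟪ p ⟫ (g ∘ suc)))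

⟪⟫-*ˡ : ∀ p c (f : ℕ → ℚ) → ⟪ p ⟫ (λ k → c * f k) ≡ c * ⟪ p ⟫ f
⟪⟫-*ˡ []      c f = sym (ℚP.*-zeroʳ c)
⟪⟫-*ˡ (a ∷ p) c f = trans (cong (a * (c * f 0) +_) (⟪⟫-*ˡ p c (f ∘ suc)))
  (solve 4 (λ a c x u → a :* (c :* x) :+ c :* u := c :* (a :* x :+ u)) refl a c (f 0) (⟪ p ⟫ (f ∘ suc)))

⟪⟫-swap : ∀ p q (g : ℕ → ℕ → ℚ) → ⟪ p ⟫ (λ i → ⟪ q ⟫ (g i)) ≡ ⟪ q ⟫ (λ j → ⟪ p ⟫ (λ i → g i j))
⟪⟫-swap []      q g = sym (⟪⟫-zero q)
⟪⟫-swap (a ∷ p) q g = sym (begin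
  ⟪ q ⟫ (λ j → a * g 0 j + ⟪ p ⟫ (λ i → g (suc i) j))             ≡⟨ ⟪⟫-+ q _ _ ⟩
  ⟪ q ⟫ (λ j → a * g 0 j) + ⟪ q ⟫ (λ j → ⟪ p ⟫ (λ i → g (suc i) j)) ≡⟨ cong₂ _+_ (⟪⟫-*ˡ q a (g 0)) (sym (⟪⟫-swap p q (g ∘ suc))) ⟩
  a * ⟪ q ⟫ (g 0) + ⟪ p ⟫ (λ i → ⟪ q ⟫ (g (suc i)))                 ∎)
  where open ≡-Reasoning

⟪⟫-addP : ∀ p q (f : ℕ → ℚ) → ⟪ addP p q ⟫ f ≡ ⟪ p ⟫ f + ⟪ q ⟫ f
⟪⟫-addP []      q       f = sym (ℚP.+-identityˡ _)
⟪⟫-addP (a ∷ p) []      f = sym (ℚP.+-identityʳ _)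
⟪⟫-addP (a ∷ p) (b ∷ q) f = trans (cong ((a + b) * f 0 +_) (⟪⟫-addP p q (f ∘ suc)))
  (solve 5 (λ a b x u v → (a :+ b) :* x :+ (u :+ v) := (a :* x :+ u) :+ (b :* x :+ v)) refl
         a b (f 0) (⟪ p ⟫ (f ∘ suc)) (⟪ q ⟫ (f ∘ suc)))

⟪⟫-scaleP : ∀ c p (f : ℕ → ℚ) → ⟪ scaleP c p ⟫ f ≡ c * ⟪ p ⟫ f
⟪⟫-scaleP c []      f = sym (ℚP.*-zeroʳ c)
⟪⟫-scaleP c (a ∷ p) f = trans (cong (c * a * f 0 +_) (⟪⟫-scaleP c p (f ∘ suc)))
  (solve 4 (λ a c x u → c :* a :* x :+ c :* u := c :* (a :* x :+ u)) refl a c (f 0) (⟪ p ⟫ (f ∘ suc)))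

⟪⟫-mulP : ∀ p q (f : ℕ → ℚ) → ⟪ mulP p q ⟫ f ≡ ⟪ p ⟫ (λ i → ⟪ q ⟫ (λ j → f (i ℕ.+ j)))
⟪⟫-mulP []      q f = refl
⟪⟫-mulP (a ∷ p) q f = begin
  ⟪ addP (scaleP a q) (0ℚ ∷ mulP p q) ⟫ f                 ≡⟨ ⟪⟫-addP (scaleP a q) (0ℚ ∷ mulP p q) f ⟩
  ⟪ scaleP a q ⟫ f + (0ℚ * f 0 + ⟪ mulP p q ⟫ (f ∘ suc))  ≡⟨ cong₂ _+_ (⟪⟫-scaleP a q f) (trans
                                                              (cong (_+ ⟪ mulP p q ⟫ (f ∘ suc)) (ℚP.*-zeroˡ (f 0)))
                                                              (ℚP.+-identityˡ _)) ⟩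
  a * ⟪ q ⟫ f + ⟪ mulP p q ⟫ (f ∘ suc)                    ≡⟨ cong (a * ⟪ q ⟫ f +_) (⟪⟫-mulP p q (f ∘ suc)) ⟩
  a * ⟪ q ⟫ f + ⟪ p ⟫ (λ i → ⟪ q ⟫ (λ j → f (suc i ℕ.+ j))) ∎
  where open ≡-Reasoning

⟪⟫-compP : ∀ p q (f : ℕ → ℚ) → ⟪ compP p q ⟫ f ≡ ⟪ p ⟫ (λ i → ⟪ powP q i ⟫ f)
⟪⟫-compP []      q f = refl
⟪⟫-compP (a ∷ p) q f = begin
  ⟪ addP (a ∷ []) (mulP q (compP p q)) ⟫ f
    ≡⟨ ⟪⟫-addP (a ∷ []) (mulP q (compP p q)) f ⟩
  (a * f 0 + 0ℚ) + ⟪ mulP q (compP p q) ⟫ f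
    ≡⟨ cong₂ _+_ (solve 2 (λ a x → a :* x :+ con 0ℚ := a :* (con 1ℚ :* x :+ con 0ℚ)) refl a (f 0))
                 (⟪⟫-mulP q (compP p q) f) ⟩
  a * f₀ + ⟪ q ⟫ (λ i → ⟪ compP p q ⟫ (λ j → f (i ℕ.+ j)))
    ≡⟨ cong (a * f₀ +_) (⟪⟫-cong q (λ i → ⟪⟫-compP p q (λ j → f (i ℕ.+ j)))) ⟩
  a * f₀ + ⟪ q ⟫ (λ i → ⟪ p ⟫ (λ m → ⟪ powP q m ⟫ (λ j → f (i ℕ.+ j))))
    ≡⟨ cong (a * f₀ +_) (⟪⟫-swap p q (λ m i → ⟪ powP q m ⟫ (λ j → f (i ℕ.+ j)))) ⟨
  a * f₀ + ⟪ p ⟫ (λ m → ⟪ q ⟫ (λ i → ⟪ powP q m ⟫ (λ j → f (i ℕ.+ j))))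
    ≡⟨ cong (a * f₀ +_) (⟪⟫-cong p (λ m → sym (⟪⟫-mulP q (powP q m) f))) ⟩
  a * f₀ + ⟪ p ⟫ (λ m → ⟪ mulP q (powP q m) ⟫ f) ∎
  where
  open ≡-Reasoning
  f₀ = ⟪ powP q 0 ⟫ f

⟪⟫-derivAux : ∀ k p (f : ℕ → ℚ) → ⟪ derivAux k p ⟫ f ≡ ⟪ p ⟫ (λ i → ℕtoℚ (k ℕ.+ i) * f i)
⟪⟫-derivAux k []      f = refl
⟪⟫-derivAux k (b ∷ p) f = cong₂ _+_
  (trans (solve 3 (λ k b x → k :* b :* x := b :* (k :* x)) refl (ℕtoℚ k) b (f 0))
         (cong (λ t → b * (ℕtoℚ t * f 0)) (sym (ℕP.+-identityʳ k))))
  (trans (⟪⟫-derivAux (suc k) p (f ∘ suc))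
         (⟪⟫-cong p (λ i → cong (λ t → ℕtoℚ t * f (suc i)) (sym (ℕP.+-suc k i)))))

⟪⟫-deriv : ∀ p (f : ℕ → ℚ) → ⟪ deriv p ⟫ f ≡ ⟪ p ⟫ (λ i → ℕtoℚ i * f (i ∸ 1))
⟪⟫-deriv []      f = refl
⟪⟫-deriv (a ∷ p) f = trans (⟪⟫-derivAux 1 p f) (sym (trans
  (cong (_+ ⟪ p ⟫ (λ i → ℕtoℚ (suc i) * f i)) (trans (cong (a *_) (ℚP.*-zeroˡ (f 0))) (ℚP.*-zeroʳ a)))
  (ℚP.+-identityˡ _)))

⟪⟫-monomial : ∀ c m (f : ℕ → ℚ) → ⟪ monomial c m ⟫ f ≡ c * f m
⟪⟫-monomial c zero    f = ℚP.+-identityʳ _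
⟪⟫-monomial c (suc m) f = trans (cong₂ _+_ (ℚP.*-zeroˡ (f 0)) (⟪⟫-monomial c m (f ∘ suc))) (ℚP.+-identityˡ _)

⟪⟫-sumP : ∀ n (g : ℕ → Poly) (f : ℕ → ℚ) → ⟪ sumP (map g (upTo n)) ⟫ f ≡ ∑ n (λ k → ⟪ g k ⟫ f)
⟪⟫-sumP n g f = go n id
  where
  go : ∀ n (h : ℕ → ℕ) → ⟪ sumP (map g (applyUpTo h n)) ⟫ f ≡ ∑ n (λ k → ⟪ g (h k) ⟫ f)
  go zero    h = refl
  go (suc n) h = trans (⟪⟫-addP (g (h 0)) _ f) (cong (⟪ g (h 0) ⟫ f +_) (go n (h ∘ suc)))

⟪⟫-binomial : ∀ u v n (f : ℕ → ℚ) →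
  ⟪ powP (u ∷ v ∷ []) n ⟫ f ≡ ∑ (suc n) (λ k → ℕtoℚ (n C k) * (u ^Q (n ∸ k) * v ^Q k * f k))
⟪⟫-binomial u v zero    f =
  solve 1 (λ x → con 1ℚ :* x :+ con 0ℚ := con 1ℚ :* (con 1ℚ :* con 1ℚ :* x) :+ con 0ℚ) refl (f 0)
⟪⟫-binomial u v (suc n) f = begin
  ⟪ mulP (u ∷ v ∷ []) P ⟫ f
    ≡⟨ ⟪⟫-mulP (u ∷ v ∷ []) P f ⟩
  u * ⟪ P ⟫ f + (v * ⟪ P ⟫ (f ∘ suc) + 0ℚ)
    ≡⟨ cong₂ (λ s t → u * s + (v * t + 0ℚ)) (⟪⟫-binomial u v n f) (⟪⟫-binomial u v n (f ∘ suc)) ⟩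
  u * ∑ (suc n) (λ k → ℕtoℚ (n C k) * (u ^Q (n ∸ k) * v ^Q k * f k))
    + (v * ∑ (suc n) (λ k → ℕtoℚ (n C k) * (u ^Q (n ∸ k) * v ^Q k * f (suc k))) + 0ℚ)
    ≡⟨ cong₂ _+_ (sym (∑-*ˡ (suc n) u (λ k → ℕtoℚ (n C k) * (u ^Q (n ∸ k) * v ^Q k * f k))))
                 (trans (ℚP.+-identityʳ _) (sym (∑-*ˡ (suc n) v (λ k → ℕtoℚ (n C k) * (u ^Q (n ∸ k) * v ^Q k * f (suc k)))))) ⟩
  ∑ (suc n) (λ k → u * (ℕtoℚ (n C k) * (u ^Q (n ∸ k) * v ^Q k * f k)))
    + ∑ (suc n) (λ k → v * (ℕtoℚ (n C k) * (u ^Q (n ∸ k) * v ^Q k * f (suc k))))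
    ≡⟨ cong₂ _+_ (∑-cong (suc n) (λ {k} → times-u k)) (∑-cong (suc n) (λ {k} _ → times-v k)) ⟩
  ∑ (suc n) (λ k → ℕtoℚ (n C k) * h k) + ∑ (suc n) (λ k → ℕtoℚ (n C k) * h (suc k))
    ≡⟨ ∑-pascal n h ⟨
  ∑ (suc (suc n)) (λ k → ℕtoℚ (suc n C k) * h k) ∎
  where
  open ≡-Reasoning
  P = powP (u ∷ v ∷ []) n
  h : ℕ → ℚ
  h k = u ^Q (suc n ∸ k) * v ^Q k * f k
  times-u : ∀ k → k < suc n → u * (ℕtoℚ (n C k) * (u ^Q (n ∸ k) * v ^Q k * f k)) ≡ ℕtoℚ (n C k) * h k
  times-u k k<1+n = trans
    (solve 5 (λ u c a b x → u :* (c :* (a :* b :* x)) := c :* ((u :* a) :* b :* x)) refl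
           u (ℕtoℚ (n C k)) (u ^Q (n ∸ k)) (v ^Q k) (f k))
    (cong (λ t → ℕtoℚ (n C k) * (u ^Q t * v ^Q k * f k)) (sym (ℕP.+-∸-assoc 1 (ℕP.≤-pred k<1+n))))
  times-v : ∀ k → v * (ℕtoℚ (n C k) * (u ^Q (n ∸ k) * v ^Q k * f (suc k))) ≡ ℕtoℚ (n C k) * h (suc k)
  times-v k = solve 5 (λ v c a b x → v :* (c :* (a :* b :* x)) := c :* (a :* (v :* b) :* x)) refl
                      v (ℕtoℚ (n C k)) (u ^Q (n ∸ k)) (v ^Q k) (f (suc k))

coeff≡⟪⟫δ : ∀ p i → coeff p i ≡ ⟪ p ⟫ (δ i)
coeff≡⟪⟫δ []      i       = refl
coeff≡⟪⟫δ (a ∷ p) zero    = sym (trans (cong₂ _+_ (ℚP.*-identityʳ a) (⟪⟫-zero p)) (ℚP.+-identityʳ a))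
coeff≡⟪⟫δ (a ∷ p) (suc i) = trans (coeff≡⟪⟫δ p i)
  (sym (trans (cong (_+ ⟪ p ⟫ (δ i)) (ℚP.*-zeroʳ a)) (ℚP.+-identityˡ _)))

evalP≡⟪⟫^ : ∀ p x → evalP p x ≡ ⟪ p ⟫ (x ^Q_)
evalP≡⟪⟫^ []      x = refl
evalP≡⟪⟫^ (a ∷ p) x = cong₂ _+_ (sym (ℚP.*-identityʳ a))
  (trans (cong (x *_) (evalP≡⟪⟫^ p x)) (sym (⟪⟫-*ˡ p x (x ^Q_))))

integralAux≡⟪⟫ : ∀ i p → integralAux i p ≡ ⟪ p ⟫ (λ k → invℕ (suc (i ℕ.+ k)))
integralAux≡⟪⟫ i []      = refl
integralAux≡⟪⟫ i (a ∷ p) = cong₂ _+_ (cong (λ t → a * invℕ (suc t)) (sym (ℕP.+-identityʳ i)))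
  (trans (integralAux≡⟪⟫ (suc i) p) (⟪⟫-cong p (λ k → cong (λ t → invℕ (suc t)) (sym (ℕP.+-suc i k)))))

S-coeff : ℕ → ℕ → ℕ → ℚ
S-coeff r n k = ℕtoℚ (n C k) * ((- 1ℚ) ^Q k) * invℕ ((r ℕ.+ k) C r)

[r+k]Cr≢0 : ∀ r k → (r ℕ.+ k) C r ≢ 0
[r+k]Cr≢0 r k = nCk≢0 (ℕP.m≤m+n r k)

⟪S⟫ : ∀ r n (f : ℕ → ℚ) → ⟪ S r n ⟫ f ≡ ∑ (suc n) (λ k → S-coeff r n k * f (n ∸ k))
⟪S⟫ r n f = trans (⟪⟫-sumP (suc n) (λ k → monomial (S-coeff r n k) (n ∸ k)) f)
  (∑-cong (suc n) (λ {k} _ → ⟪⟫-monomial (S-coeff r n k) (n ∸ k) f))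

⟪S⟫δ : ∀ r n i → ⟪ S r n ⟫ (δ i) ≡ ∑ (suc n) (λ j → S-coeff r n (n ∸ j) * δ i j)
⟪S⟫δ r n i = trans (⟪S⟫ r n (δ i)) (trans (∑-reverse n (λ k → S-coeff r n k * δ i (n ∸ k)))
  (∑-cong (suc n) (λ {j} j<1+n → cong (λ t → S-coeff r n (n ∸ j) * δ i t) (ℕP.m∸[m∸n]≡n (ℕP.≤-pred j<1+n)))))

⟪S⟫δ≡S-coeff : ∀ r {n i} → i ≤ n → ⟪ S r n ⟫ (δ i) ≡ S-coeff r n (n ∸ i)
⟪S⟫δ≡S-coeff r {n} {i} i≤n = trans (⟪S⟫δ r n i) (∑-δ (suc n) i (λ j → S-coeff r n (n ∸ j)) (s≤s i≤n))

⟪S⟫δ≡0 : ∀ r {n i} → n < i → ⟪ S r n ⟫ (δ i) ≡ 0ℚ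
⟪S⟫δ≡0 r {n} {i} n<i = trans (⟪S⟫δ r n i) (∑-δ-out (suc n) i (λ j → S-coeff r n (n ∸ j)) n<i)

coeff-scaleP : ∀ c p i → coeff (scaleP c p) i ≡ c * ⟪ p ⟫ (δ i)
coeff-scaleP c p i = trans (coeff≡⟪⟫δ (scaleP c p) i) (⟪⟫-scaleP c p (δ i))

S-coeff≡falling : ∀ r n k → S-coeff r n k ≡ ℕtoℚ (ff n k) * invℕ (ff (r ℕ.+ k) k) * ((- 1ℚ) ^Q k)
S-coeff≡falling r n k = trans
  (solve 3 (λ c s i → c :* s :* i := c :* i :* s) refl (ℕtoℚ (n C k)) ((- 1ℚ) ^Q k) (invℕ D))
  (cong (_* ((- 1ℚ) ^Q k)) (a/b≡c/d (n C k) D (ff n k) (ff (r ℕ.+ k) k) ([r+k]Cr≢0 r k) ff≢0 cross))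
  where
  D = (r ℕ.+ k) C r
  ff≢0 : ff (r ℕ.+ k) k ≢ 0
  ff≢0 ff≡0 = [r+k]Cr≢0 r k (ℕP.m*n≡0⇒m≡0 D (k !) {{k !≢0}} (trans ([r+k]Cr*k!≡ff r k) ff≡0))
  cross : (n C k) ℕ.* ff (r ℕ.+ k) k ≡ ff n k ℕ.* D
  cross = begin
    (n C k) ℕ.* ff (r ℕ.+ k) k      ≡⟨ cong ((n C k) ℕ.*_) ([r+k]Cr*k!≡ff r k) ⟨
    (n C k) ℕ.* (D ℕ.* k !)         ≡⟨ cong ((n C k) ℕ.*_) (ℕP.*-comm D (k !)) ⟩
    (n C k) ℕ.* (k ! ℕ.* D)         ≡⟨ ℕP.*-assoc (n C k) (k !) D ⟨
    (n C k) ℕ.* k ! ℕ.* D           ≡⟨ cong (ℕ._* D) (nCk*k!≡ff n k) ⟩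
    ff n k ℕ.* D                    ∎
    where open ≡-Reasoning

S≈falling : ∀ r n →
  S r n ≈P sumP (map (λ k → monomial (ℕtoℚ (ff n k) * invℕ (ff (r ℕ.+ k) k) * ((- 1ℚ) ^Q k)) (n ∸ k)) (upTo (suc n)))
S≈falling r n i = cong (λ p → coeff p i)
  (cong sumP (ListP.map-cong (λ k → cong (λ c → monomial c (n ∸ k)) (S-coeff≡falling r n k)) (upTo (suc n))))

[1+m∸k]*S-coeff : ∀ r {m k} → k ≤ m →
  ℕtoℚ (suc m ∸ k) * S-coeff r (suc m) k ≡ ℕtoℚ (suc m) * S-coeff r m k
[1+m∸k]*S-coeff r {m} {k} k≤m = begin
  ℕtoℚ (suc m ∸ k) * (ℕtoℚ (suc m C k) * s * c)
    ≡⟨ solve 4 (λ a b s c → a :* (b :* s :* c) := (a :* b) :* (s :* c)) refl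
             (ℕtoℚ (suc m ∸ k)) (ℕtoℚ (suc m C k)) s c ⟩
  (ℕtoℚ (suc m ∸ k) * ℕtoℚ (suc m C k)) * (s * c)
    ≡⟨ cong (_* (s * c)) (trans (sym (ℕtoℚ-* (suc m ∸ k) (suc m C k)))
         (trans (cong ℕtoℚ ([1+m∸k]*[1+m]Ck≡[1+m]*mCk k≤m)) (ℕtoℚ-* (suc m) (m C k)))) ⟩
  (ℕtoℚ (suc m) * ℕtoℚ (m C k)) * (s * c)
    ≡⟨ solve 4 (λ a b s c → (a :* b) :* (s :* c) := a :* (b :* s :* c)) refl (ℕtoℚ (suc m)) (ℕtoℚ (m C k)) s c ⟩
  ℕtoℚ (suc m) * S-coeff r m k ∎
  where
  open ≡-Reasoning
  s = (- 1ℚ) ^Q k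
  c = invℕ ((r ℕ.+ k) C r)

deriv-S : ∀ r m → deriv (S r (suc m)) ≈P scaleP (ℕtoℚ (suc m)) (S r m)
deriv-S r m i = begin
  coeff (deriv (S r (suc m))) i                       ≡⟨ coeff≡⟪⟫δ (deriv (S r (suc m))) i ⟩
  ⟪ deriv (S r (suc m)) ⟫ (δ i)                       ≡⟨ ⟪⟫-deriv (S r (suc m)) (δ i) ⟩
  ⟪ S r (suc m) ⟫ (λ j → ℕtoℚ j * δ i (j ∸ 1))        ≡⟨ ⟪S⟫ r (suc m) (λ j → ℕtoℚ j * δ i (j ∸ 1)) ⟩
  ∑ (suc (suc m)) h                                   ≡⟨ ∑-suc (suc m) h ⟩
  ∑ (suc m) h + h (suc m)                             ≡⟨ cong (λ t → ∑ (suc m) h + t) h[1+m]≡0 ⟩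
  ∑ (suc m) h + 0ℚ                                    ≡⟨ ℚP.+-identityʳ _ ⟩
  ∑ (suc m) h                                         ≡⟨ ∑-cong (suc m) (λ {k} → h≡ k) ⟩
  ∑ (suc m) (λ k → ℕtoℚ (suc m) * (S-coeff r m k * δ i (m ∸ k)))
    ≡⟨ ∑-*ˡ (suc m) (ℕtoℚ (suc m)) (λ k → S-coeff r m k * δ i (m ∸ k)) ⟩
  ℕtoℚ (suc m) * ∑ (suc m) (λ k → S-coeff r m k * δ i (m ∸ k))
    ≡⟨ cong (ℕtoℚ (suc m) *_) (⟪S⟫ r m (δ i)) ⟨
  ℕtoℚ (suc m) * ⟪ S r m ⟫ (δ i)                      ≡⟨ coeff-scaleP (ℕtoℚ (suc m)) (S r m) i ⟨
  coeff (scaleP (ℕtoℚ (suc m)) (S r m)) i             ∎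
  where
  open ≡-Reasoning
  h : ℕ → ℚ
  h k = S-coeff r (suc m) k * (ℕtoℚ (suc m ∸ k) * δ i (suc m ∸ k ∸ 1))
  h[1+m]≡0 : h (suc m) ≡ 0ℚ
  h[1+m]≡0 = trans (cong (λ t → S-coeff r (suc m) (suc m) * (ℕtoℚ t * δ i (t ∸ 1))) (ℕP.n∸n≡0 (suc m)))
    (trans (cong (S-coeff r (suc m) (suc m) *_) (ℚP.*-zeroˡ (δ i 0))) (ℚP.*-zeroʳ (S-coeff r (suc m) (suc m))))
  h≡ : ∀ k → k < suc m → h k ≡ ℕtoℚ (suc m) * (S-coeff r m k * δ i (m ∸ k))
  h≡ k k<1+m = begin
    S-coeff r (suc m) k * (ℕtoℚ (suc m ∸ k) * δ i (suc m ∸ k ∸ 1))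
      ≡⟨ cong (λ t → S-coeff r (suc m) k * (ℕtoℚ (suc m ∸ k) * δ i (t ∸ 1))) (ℕP.+-∸-assoc 1 k≤m) ⟩
    S-coeff r (suc m) k * (ℕtoℚ (suc m ∸ k) * δ i (m ∸ k))
      ≡⟨ solve 3 (λ a b d → a :* (b :* d) := (b :* a) :* d) refl (S-coeff r (suc m) k) (ℕtoℚ (suc m ∸ k)) (δ i (m ∸ k)) ⟩
    ℕtoℚ (suc m ∸ k) * S-coeff r (suc m) k * δ i (m ∸ k)
      ≡⟨ cong (_* δ i (m ∸ k)) ([1+m∸k]*S-coeff r k≤m) ⟩
    ℕtoℚ (suc m) * S-coeff r m k * δ i (m ∸ k)
      ≡⟨ ℚP.*-assoc (ℕtoℚ (suc m)) (S-coeff r m k) (δ i (m ∸ k)) ⟩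
    ℕtoℚ (suc m) * (S-coeff r m k * δ i (m ∸ k)) ∎
    where k≤m = ℕP.≤-pred k<1+m

[r+n]Cr*S-coeff : ∀ r {n k} → k ≤ n →
  ℕtoℚ ((r ℕ.+ n) C r) * S-coeff r n k ≡ ℕtoℚ ((r ℕ.+ n) C (n ∸ k)) * (- 1ℚ) ^Q k
[r+n]Cr*S-coeff r {n} {k} k≤n = begin
  ℕtoℚ D * (ℕtoℚ (n C k) * s * invℕ Dₖ)
    ≡⟨ solve 4 (λ d c s i → d :* (c :* s :* i) := (d :* c) :* s :* i) refl (ℕtoℚ D) (ℕtoℚ (n C k)) s (invℕ Dₖ) ⟩
  (ℕtoℚ D * ℕtoℚ (n C k)) * s * invℕ Dₖ
    ≡⟨ cong (λ t → t * s * invℕ Dₖ) (trans (sym (ℕtoℚ-* D (n C k)))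
         (trans (cong ℕtoℚ ([r+n]Cr*nCk≡[r+n]C[n∸k]*[r+k]Cr r k≤n)) (ℕtoℚ-* E Dₖ))) ⟩
  (ℕtoℚ E * ℕtoℚ Dₖ) * s * invℕ Dₖ
    ≡⟨ solve 4 (λ e d s i → (e :* d) :* s :* i := e :* s :* (d :* i)) refl (ℕtoℚ E) (ℕtoℚ Dₖ) s (invℕ Dₖ) ⟩
  ℕtoℚ E * s * (ℕtoℚ Dₖ * invℕ Dₖ)
    ≡⟨ cong (ℕtoℚ E * s *_) (ℕtoℚ*invℕ≡1 ([r+k]Cr≢0 r k)) ⟩
  ℕtoℚ E * s * 1ℚ
    ≡⟨ ℚP.*-identityʳ _ ⟩
  ℕtoℚ E * s ∎
  where
  open ≡-Reasoning
  D = (r ℕ.+ n) C r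
  Dₖ = (r ℕ.+ k) C r
  E = (r ℕ.+ n) C (n ∸ k)
  s = (- 1ℚ) ^Q k

IsFromℤ-[r+n]Cr*S-coeff : ∀ r {n k} → k ≤ n → IsFromℤ (ℕtoℚ ((r ℕ.+ n) C r) * S-coeff r n k)
IsFromℤ-[r+n]Cr*S-coeff r {n} {k} k≤n =
  subst IsFromℤ (sym ([r+n]Cr*S-coeff r k≤n)) (IsFromℤ-* (ℤ.+ ((r ℕ.+ n) C (n ∸ k)) , refl) (IsFromℤ-sign k))

IntegralPoly-[r+n]Cr*S : ∀ r n → IntegralPoly (scaleP (ℕtoℚ ((r ℕ.+ n) C r)) (S r n))
IntegralPoly-[r+n]Cr*S r n i =
  IsFromℤ⇒IsIntegral (subst IsFromℤ (sym (coeff-scaleP D (S r n) i)) (by-degree (ℕP.≤-<-connex i n)))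
  where
  D = ℕtoℚ ((r ℕ.+ n) C r)
  by-degree : i ≤ n ⊎ n < i → IsFromℤ (D * ⟪ S r n ⟫ (δ i))
  by-degree (inj₁ i≤n) = subst IsFromℤ (cong (D *_) (sym (⟪S⟫δ≡S-coeff r i≤n)))
    (IsFromℤ-[r+n]Cr*S-coeff r (ℕP.m∸n≤m n i))
  by-degree (inj₂ n<i) = ℤ.+ 0 , trans (cong (D *_) (⟪S⟫δ≡0 r n<i)) (ℚP.*-zeroʳ D)

[r+n]Cr∣ : ∀ r n d → IntegralPoly (scaleP (ℕtoℚ d) (S r n)) → (r ℕ.+ n) C r ∣ d
[r+n]Cr∣ r n d dS-integral with IsIntegral⇒IsFromℤ (dS-integral 0) | IsFromℤ-sign n
... | z , c₀≡z | σ , s≡σ =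
  divides ℤ.∣ z ℤ.* σ ∣ (trans (cong ℤ.∣_∣ (fromℤ-injective (ℤ.+ d) (z ℤ.* σ ℤ.* ℤ.+ D) d≡zσD)) (ℤP.abs-* (z ℤ.* σ) (ℤ.+ D)))
  where
  D = (r ℕ.+ n) C r
  s = (- 1ℚ) ^Q n
  c₀≡ : coeff (scaleP (ℕtoℚ d) (S r n)) 0 ≡ ℕtoℚ d * (1ℚ * s * invℕ D)
  c₀≡ = trans (coeff-scaleP (ℕtoℚ d) (S r n) 0)
    (cong (ℕtoℚ d *_) (trans (⟪S⟫δ≡S-coeff r {n} z≤n) (cong (λ t → ℕtoℚ t * s * invℕ D) (nCn≡1 n))))
  d≡zσD : ℕtoℚ d ≡ fromℤ (z ℤ.* σ ℤ.* ℤ.+ D)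
  d≡zσD = begin
    ℕtoℚ d                                   ≡⟨ ℚP.*-identityʳ _ ⟨
    ℕtoℚ d * 1ℚ                              ≡⟨ cong (ℕtoℚ d *_) (cong₂ _*_ (-1^k*-1^k≡1 n) (ℕtoℚ*invℕ≡1 ([r+k]Cr≢0 r n))) ⟨
    ℕtoℚ d * ((s * s) * (ℕtoℚ D * invℕ D))
      ≡⟨ solve 4 (λ d s D i → d :* ((s :* s) :* (D :* i)) := d :* (con 1ℚ :* s :* i) :* s :* D) refl
               (ℕtoℚ d) s (ℕtoℚ D) (invℕ D) ⟩
    ℕtoℚ d * (1ℚ * s * invℕ D) * s * ℕtoℚ D  ≡⟨ cong (λ t → t * s * ℕtoℚ D) (trans (sym c₀≡) c₀≡z) ⟩
    fromℤ z * s * ℕtoℚ D                     ≡⟨ cong (λ t → fromℤ z * t * ℕtoℚ D) s≡σ ⟩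
    fromℤ z * fromℤ σ * fromℤ (ℤ.+ D)          ≡⟨ cong (_* fromℤ (ℤ.+ D)) (fromℤ-* z σ) ⟨
    fromℤ (z ℤ.* σ) * fromℤ (ℤ.+ D)            ≡⟨ fromℤ-* (z ℤ.* σ) (ℤ.+ D) ⟨
    fromℤ (z ℤ.* σ ℤ.* ℤ.+ D)                  ∎
    where open ≡-Reasoning

IsDenomP-S : ∀ r n → IsDenomP ((r ℕ.+ n) C r) (S r n)
IsDenomP-S r n = ℕP.n≢0⇒n>0 ([r+k]Cr≢0 r n) , IntegralPoly-[r+n]Cr*S r n ,
  λ d 1≤d dS-integral → ∣⇒≤ {{ℕ.>-nonZero 1≤d}} ([r+n]Cr∣ r n d dS-integral)

↧ₙ[S-at-ℤ]∣ : ∀ r n (ℓ : ℤ) → ↧ₙ (evalP (S r n) (ℓ / 1)) ∣ ((r ℕ.+ n) C r)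
↧ₙ[S-at-ℤ]∣ r n ℓ = IsFromℤ-*⇒↧ₙ∣ (evalP (S r n) (fromℤ ℓ)) ([r+k]Cr≢0 r n)
  (subst IsFromℤ (sym Dq≡∑g) ∑g-integral)
  where
  D = (r ℕ.+ n) C r
  g : ℕ → ℚ
  g k = ℕtoℚ D * S-coeff r n k * fromℤ ℓ ^Q (n ∸ k)
  ∑g-integral : IsFromℤ (∑ (suc n) g)
  ∑g-integral = IsFromℤ-∑ (suc n) g (λ {k} k<1+n →
    IsFromℤ-* (IsFromℤ-[r+n]Cr*S-coeff r (ℕP.≤-pred k<1+n)) (IsFromℤ-^ (n ∸ k) (ℓ , refl)))
  Dq≡∑g : ℕtoℚ D * evalP (S r n) (fromℤ ℓ) ≡ ∑ (suc n) g
  Dq≡∑g = trans (cong (ℕtoℚ D *_) (trans (evalP≡⟪⟫^ (S r n) (fromℤ ℓ)) (⟪S⟫ r n (fromℤ ℓ ^Q_))))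
    (trans (sym (∑-*ˡ (suc n) (ℕtoℚ D) (λ k → S-coeff r n k * fromℤ ℓ ^Q (n ∸ k))))
           (∑-cong (suc n) (λ {k} _ → sym (ℚP.*-assoc (ℕtoℚ D) (S-coeff r n k) (fromℤ ℓ ^Q (n ∸ k))))))

-- The Beta integral

-- k! R! / (k+R+1)! = ∫₀¹ tᵏ (1-t)ᴿ dt
beta : ℕ → ℕ → ℚ
beta k R = ℕtoℚ (k ! ℕ.* R !) * invℕ ((suc (k ℕ.+ R)) !)

beta-zero : ∀ k → ℕtoℚ 1 * invℕ (suc (k ℕ.+ 0)) ≡ beta k 0
beta-zero k = a/b≡c/d 1 (suc (k ℕ.+ 0)) (k ! ℕ.* 1) ((suc (k ℕ.+ 0)) !) (λ ()) (n!≢0 (suc (k ℕ.+ 0))) cross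
  where
  cross : 1 ℕ.* (suc (k ℕ.+ 0)) ! ≡ k ! ℕ.* 1 ℕ.* suc (k ℕ.+ 0)
  cross rewrite ℕP.+-identityʳ k = trans (ℕP.*-identityˡ _)
    (trans (ℕP.*-comm (suc k) (k !)) (cong (ℕ._* suc k) (sym (ℕP.*-identityʳ (k !)))))

beta-suc : ∀ k R → beta k R + (- 1ℚ) * beta (suc k) R ≡ beta k (suc R)
beta-suc k R = begin
  beta k R + (- 1ℚ) * beta (suc k) R
    ≡⟨ cong (_+ (- 1ℚ) * beta (suc k) R) (a/b≡c/d (k ! ℕ.* R !) ((suc (k ℕ.+ R)) !) A ((suc (suc (k ℕ.+ R))) !) (n!≢0 (suc (k ℕ.+ R))) (n!≢0 (suc (suc (k ℕ.+ R))))
         (sym (ℕP.*-assoc (k ! ℕ.* R !) (suc (suc (k ℕ.+ R))) ((suc (k ℕ.+ R)) !)))) ⟩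
  ℕtoℚ A * N⁻¹ + (- 1ℚ) * (ℕtoℚ B * N⁻¹)
    ≡⟨ cong (λ t → t * N⁻¹ + (- 1ℚ) * (ℕtoℚ B * N⁻¹))
         (trans (cong ℕtoℚ (k!*R!*[2+k+R]≡[1+k]!*R!+k!*[1+R]! k R)) (ℕtoℚ-+ B C′)) ⟩
  (ℕtoℚ B + ℕtoℚ C′) * N⁻¹ + (- 1ℚ) * (ℕtoℚ B * N⁻¹)
    ≡⟨ solve 3 (λ b c i → (b :+ c) :* i :+ (:- con 1ℚ) :* (b :* i) := c :* i) refl (ℕtoℚ B) (ℕtoℚ C′) N⁻¹ ⟩
  ℕtoℚ C′ * N⁻¹
    ≡⟨ cong (λ t → ℕtoℚ C′ * invℕ ((suc t) !)) (ℕP.+-suc k R) ⟨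
  beta k (suc R) ∎
  where
  open ≡-Reasoning
  N⁻¹ = invℕ ((suc (suc (k ℕ.+ R))) !)
  A = k ! ℕ.* R ! ℕ.* suc (suc (k ℕ.+ R))
  B = (suc k) ! ℕ.* R !
  C′ = k ! ℕ.* (suc R) !

-- Induction on R mirrors (1-t)^(R+1) = (1-t)ᴿ - t (1-t)ᴿ, i.e. Pascal's rule for C(R+1, j).
∑≡beta : ∀ R k → ∑ (suc R) (λ j → ℕtoℚ (R C j) * ((- 1ℚ) ^Q j * invℕ (suc (k ℕ.+ j)))) ≡ beta k R
∑≡beta zero    k = trans (solve 2 (λ c i → c :* (con 1ℚ :* i) :+ con 0ℚ := c :* i) refl (ℕtoℚ 1) (invℕ (suc (k ℕ.+ 0))))
  (beta-zero k)
∑≡beta (suc R) k = begin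
  ∑ (suc (suc R)) (λ j → ℕtoℚ (suc R C j) * f j)
    ≡⟨ ∑-pascal R f ⟩
  ∑ (suc R) (λ j → ℕtoℚ (R C j) * f j) + ∑ (suc R) (λ j → ℕtoℚ (R C j) * f (suc j))
    ≡⟨ cong (∑ (suc R) (λ j → ℕtoℚ (R C j) * f j) +_)
         (trans (∑-cong (suc R) (λ {j} _ → shift j)) (∑-*ˡ (suc R) (- 1ℚ) (λ j → ℕtoℚ (R C j) * f′ j))) ⟩
  ∑ (suc R) (λ j → ℕtoℚ (R C j) * f j) + (- 1ℚ) * ∑ (suc R) (λ j → ℕtoℚ (R C j) * f′ j)
    ≡⟨ cong₂ (λ a b → a + (- 1ℚ) * b) (∑≡beta R k) (∑≡beta R (suc k)) ⟩
  beta k R + (- 1ℚ) * beta (suc k) R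
    ≡⟨ beta-suc k R ⟩
  beta k (suc R) ∎
  where
  open ≡-Reasoning
  f f′ : ℕ → ℚ
  f j = (- 1ℚ) ^Q j * invℕ (suc (k ℕ.+ j))
  f′ j = (- 1ℚ) ^Q j * invℕ (suc (suc k ℕ.+ j))
  shift : ∀ j → ℕtoℚ (R C j) * f (suc j) ≡ (- 1ℚ) * (ℕtoℚ (R C j) * f′ j)
  shift j = trans (cong (λ t → ℕtoℚ (R C j) * ((- 1ℚ) ^Q suc j * invℕ (suc t))) (ℕP.+-suc k j))
    (solve 4 (λ c m s i → c :* ((m :* s) :* i) := m :* (c :* (s :* i))) refl
           (ℕtoℚ (R C j)) (- 1ℚ) ((- 1ℚ) ^Q j) (invℕ (suc (suc k ℕ.+ j))))

[1+R]*beta≡1/C : ∀ R k → ℕtoℚ (suc R) * beta k R ≡ invℕ ((suc R ℕ.+ k) C suc R)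
[1+R]*beta≡1/C R k = begin
  ℕtoℚ (suc R) * (ℕtoℚ (k ! ℕ.* R !) * N⁻¹)  ≡⟨ ℚP.*-assoc (ℕtoℚ (suc R)) (ℕtoℚ (k ! ℕ.* R !)) N⁻¹ ⟨
  ℕtoℚ (suc R) * ℕtoℚ (k ! ℕ.* R !) * N⁻¹    ≡⟨ cong (_* N⁻¹) (ℕtoℚ-* (suc R) (k ! ℕ.* R !)) ⟨
  ℕtoℚ (suc R ℕ.* (k ! ℕ.* R !)) * N⁻¹       ≡⟨ a/b≡c/d (suc R ℕ.* (k ! ℕ.* R !)) ((suc (k ℕ.+ R)) !) 1 Dₖ (n!≢0 (suc (k ℕ.+ R))) ([r+k]Cr≢0 (suc R) k) cross ⟩
  ℕtoℚ 1 * invℕ Dₖ                           ≡⟨ ℚP.*-identityˡ _ ⟩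
  invℕ Dₖ                                    ∎
  where
  open ≡-Reasoning
  N⁻¹ = invℕ ((suc (k ℕ.+ R)) !)
  Dₖ = (suc R ℕ.+ k) C suc R
  cross : suc R ℕ.* (k ! ℕ.* R !) ℕ.* Dₖ ≡ 1 ℕ.* (suc (k ℕ.+ R)) !
  cross = trans ([1+R]*[k!*R!]*[1+R+k]C[1+R]≡[1+k+R]! R k) (sym (ℕP.*-identityˡ _))

[1+R]*∫t^k[1-t]^R : ∀ R k →
  ℕtoℚ (suc R) * ⟪ powP (1ℚ ∷ - 1ℚ ∷ []) R ⟫ (λ j → invℕ (suc (k ℕ.+ j))) ≡ invℕ ((suc R ℕ.+ k) C suc R)
[1+R]*∫t^k[1-t]^R R k = trans (cong (ℕtoℚ (suc R) *_) (begin
  ⟪ powP (1ℚ ∷ - 1ℚ ∷ []) R ⟫ (λ j → invℕ (suc (k ℕ.+ j)))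
    ≡⟨ ⟪⟫-binomial 1ℚ (- 1ℚ) R _ ⟩
  ∑ (suc R) (λ j → ℕtoℚ (R C j) * (1ℚ ^Q (R ∸ j) * (- 1ℚ) ^Q j * invℕ (suc (k ℕ.+ j))))
    ≡⟨ ∑-cong (suc R) (λ {j} _ → cong (λ t → ℕtoℚ (R C j) * t)
         (trans (cong (λ t → t * (- 1ℚ) ^Q j * invℕ (suc (k ℕ.+ j))) (1^k≡1 (R ∸ j)))
                (solve 2 (λ s i → con 1ℚ :* s :* i := s :* i) refl ((- 1ℚ) ^Q j) (invℕ (suc (k ℕ.+ j)))))) ⟩
  ∑ (suc R) (λ j → ℕtoℚ (R C j) * ((- 1ℚ) ^Q j * invℕ (suc (k ℕ.+ j))))
    ≡⟨ ∑≡beta R k ⟩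
  beta k R ∎))
  ([1+R]*beta≡1/C R k)
  where open ≡-Reasoning

S≡[1+R]*∫ : ∀ R n x →
  evalP (S (suc R) n) x ≡ ℕtoℚ (suc R) * integral01 (mulP (powP (x ∷ - 1ℚ ∷ []) n) (powP (1ℚ ∷ - 1ℚ ∷ []) R))
S≡[1+R]*∫ R n x = begin
  evalP (S (suc R) n) x
    ≡⟨ trans (evalP≡⟪⟫^ (S (suc R) n) x) (⟪S⟫ (suc R) n (x ^Q_)) ⟩
  ∑ (suc n) (λ k → S-coeff (suc R) n k * x ^Q (n ∸ k))
    ≡⟨ ∑-cong (suc n) (λ {k} _ → term k) ⟩
  ∑ (suc n) (λ k → ℕtoℚ (suc R) * g k)
    ≡⟨ ∑-*ˡ (suc n) (ℕtoℚ (suc R)) g ⟩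
  ℕtoℚ (suc R) * ∑ (suc n) g
    ≡⟨ cong (ℕtoℚ (suc R) *_) (⟪⟫-binomial x (- 1ℚ) n β) ⟨
  ℕtoℚ (suc R) * ⟪ powP (x ∷ - 1ℚ ∷ []) n ⟫ β
    ≡⟨ cong (ℕtoℚ (suc R) *_) (trans (integralAux≡⟪⟫ 0 P) (⟪⟫-mulP (powP (x ∷ - 1ℚ ∷ []) n) Q _)) ⟨
  ℕtoℚ (suc R) * integral01 P ∎
  where
  open ≡-Reasoning
  Q = powP (1ℚ ∷ - 1ℚ ∷ []) R
  P = mulP (powP (x ∷ - 1ℚ ∷ []) n) Q
  β : ℕ → ℚ
  β k = ⟪ Q ⟫ (λ j → invℕ (suc (k ℕ.+ j)))
  g : ℕ → ℚ
  g k = ℕtoℚ (n C k) * (x ^Q (n ∸ k) * (- 1ℚ) ^Q k * β k)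
  term : ∀ k → S-coeff (suc R) n k * x ^Q (n ∸ k) ≡ ℕtoℚ (suc R) * g k
  term k = sym (trans
    (solve 5 (λ r c xp s b → r :* (c :* (xp :* s :* b)) := c :* s :* (r :* b) :* xp) refl
           (ℕtoℚ (suc R)) (ℕtoℚ (n C k)) (x ^Q (n ∸ k)) ((- 1ℚ) ^Q k) (β k))
    (cong (λ t → ℕtoℚ (n C k) * (- 1ℚ) ^Q k * t * x ^Q (n ∸ k)) ([1+R]*∫t^k[1-t]^R R k)))

-- Translation

n∸i<j⇒n∸j<i : ∀ {n i j} → 0 < i → i ≤ n → n ∸ i < j → n ∸ j < i
n∸i<j⇒n∸j<i {n} {i} {j} 0<i i≤n n∸i<j with ℕP.≤-<-connex j n
... | inj₁ j≤n = subst (n ∸ j <_) (ℕP.m∸[m∸n]≡n i≤n) (ℕP.∸-monoʳ-< n∸i<j j≤n)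
... | inj₂ n<j = subst (_< i) (sym (ℕP.m≤n⇒m∸n≡0 (ℕP.<⇒≤ n<j))) 0<i

⟪[y+x]^m⟫δ : ∀ y m i → ⟪ powP (y ∷ 1ℚ ∷ []) m ⟫ (δ i) ≡ ℕtoℚ (m C i) * y ^Q (m ∸ i)
⟪[y+x]^m⟫δ y m i = trans (⟪⟫-binomial y 1ℚ m (δ i)) (trans (∑-cong (suc m) (λ {j} _ → drop-1^j j)) (by-degree (ℕP.≤-<-connex i m)))
  where
  t : ℕ → ℚ
  t j = ℕtoℚ (m C j) * y ^Q (m ∸ j)
  drop-1^j : ∀ j → ℕtoℚ (m C j) * (y ^Q (m ∸ j) * 1ℚ ^Q j * δ i j) ≡ t j * δ i j
  drop-1^j j = trans (cong (λ u → ℕtoℚ (m C j) * (y ^Q (m ∸ j) * u * δ i j)) (1^k≡1 j))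
    (solve 3 (λ c a d → c :* (a :* con 1ℚ :* d) := c :* a :* d) refl (ℕtoℚ (m C j)) (y ^Q (m ∸ j)) (δ i j))
  by-degree : i ≤ m ⊎ m < i → ∑ (suc m) (λ j → t j * δ i j) ≡ t i
  by-degree (inj₁ i≤m) = ∑-δ (suc m) i t (s≤s i≤m)
  by-degree (inj₂ m<i) = trans (∑-δ-out (suc m) i t m<i)
    (sym (trans (cong (λ c → ℕtoℚ c * y ^Q (m ∸ i)) (k>n⇒nCk≡0 m<i)) (ℚP.*-zeroˡ (y ^Q (m ∸ i)))))

S-coeff*[n∸k]Ci : ∀ r {n k i} y → i ℕ.+ k ≤ n →
  S-coeff r n k * (ℕtoℚ ((n ∸ k) C i) * y ^Q (n ∸ k ∸ i))
    ≡ ℕtoℚ (n C (i ℕ.+ k)) * y ^Q (n ∸ (i ℕ.+ k)) * S-coeff r (i ℕ.+ k) k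
S-coeff*[n∸k]Ci r {n} {k} {i} y i+k≤n = begin
  S-coeff r n k * (ℕtoℚ ((n ∸ k) C i) * y ^Q (n ∸ k ∸ i))
    ≡⟨ cong (λ j → S-coeff r n k * (ℕtoℚ ((n ∸ k) C i) * y ^Q j)) n∸k∸i≡n∸[i+k] ⟩
  ℕtoℚ (n C k) * s * Dₖ⁻¹ * (ℕtoℚ ((n ∸ k) C i) * yᵖ)
    ≡⟨ solve 5 (λ a s d b y → a :* s :* d :* (b :* y) := (a :* b) :* (s :* d :* y)) refl
             (ℕtoℚ (n C k)) s Dₖ⁻¹ (ℕtoℚ ((n ∸ k) C i)) yᵖ ⟩
  (ℕtoℚ (n C k) * ℕtoℚ ((n ∸ k) C i)) * (s * Dₖ⁻¹ * yᵖ)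
    ≡⟨ cong (_* (s * Dₖ⁻¹ * yᵖ)) (trans (sym (ℕtoℚ-* (n C k) ((n ∸ k) C i)))
         (trans (cong ℕtoℚ (nCk*[n∸k]Ci≡nC[i+k]*[i+k]Ck {n} {k} {i} i+k≤n)) (ℕtoℚ-* (n C (i ℕ.+ k)) ((i ℕ.+ k) C k)))) ⟩
  (ℕtoℚ (n C (i ℕ.+ k)) * ℕtoℚ ((i ℕ.+ k) C k)) * (s * Dₖ⁻¹ * yᵖ)
    ≡⟨ solve 5 (λ a b s d y → (a :* b) :* (s :* d :* y) := a :* y :* (b :* s :* d)) refl
             (ℕtoℚ (n C (i ℕ.+ k))) (ℕtoℚ ((i ℕ.+ k) C k)) s Dₖ⁻¹ yᵖ ⟩
  ℕtoℚ (n C (i ℕ.+ k)) * yᵖ * S-coeff r (i ℕ.+ k) k ∎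
  where
  open ≡-Reasoning
  s = (- 1ℚ) ^Q k
  Dₖ⁻¹ = invℕ ((r ℕ.+ k) C r)
  yᵖ = y ^Q (n ∸ (i ℕ.+ k))
  n∸k∸i≡n∸[i+k] : n ∸ k ∸ i ≡ n ∸ (i ℕ.+ k)
  n∸k∸i≡n∸[i+k] = trans (ℕP.∸-+-assoc n k i) (cong (n ∸_) (ℕP.+-comm k i))

∑-translate : ∀ r n y i →
  ∑ (suc n) (λ k → S-coeff r n k * (ℕtoℚ ((n ∸ k) C i) * y ^Q (n ∸ k ∸ i)))
    ≡ ∑ (suc n) (λ k → ℕtoℚ (n C k) * y ^Q (n ∸ k) * ⟪ S r k ⟫ (δ i))
∑-translate r n y i = by-degree (ℕP.≤-<-connex i n)
  where
  open ≡-Reasoning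
  t lhs rhs : ℕ → ℚ
  t m = ℕtoℚ (m C i) * y ^Q (m ∸ i)
  lhs k = S-coeff r n k * t (n ∸ k)
  rhs k = ℕtoℚ (n C k) * y ^Q (n ∸ k) * ⟪ S r k ⟫ (δ i)
  lhs≡0 : ∀ {k} → n ∸ k < i → lhs k ≡ 0ℚ
  lhs≡0 {k} n∸k<i = trans (cong (S-coeff r n k *_) (cong (λ c → ℕtoℚ c * y ^Q (n ∸ k ∸ i)) (k>n⇒nCk≡0 n∸k<i)))
    (trans (cong (S-coeff r n k *_) (ℚP.*-zeroˡ (y ^Q (n ∸ k ∸ i)))) (ℚP.*-zeroʳ (S-coeff r n k)))
  rhs≡0 : ∀ {k} → k < i → rhs k ≡ 0ℚ
  rhs≡0 {k} k<i = trans (cong (ℕtoℚ (n C k) * y ^Q (n ∸ k) *_) (⟪S⟫δ≡0 r k<i)) (ℚP.*-zeroʳ (ℕtoℚ (n C k) * y ^Q (n ∸ k)))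
  by-degree : i ≤ n ⊎ n < i → ∑ (suc n) lhs ≡ ∑ (suc n) rhs
  by-degree (inj₂ n<i) = trans (∑-zero (suc n) (λ {k} _ → lhs≡0 {k} (ℕP.≤-<-trans (ℕP.m∸n≤m n k) n<i)))
    (sym (∑-zero (suc n) (λ k<1+n → rhs≡0 (ℕP.≤-<-trans (ℕP.≤-pred k<1+n) n<i))))
  by-degree (inj₁ i≤n) = begin
    ∑ (suc n) lhs             ≡⟨ cong (λ m → ∑ (suc m) lhs) (ℕP.m∸n+n≡m i≤n) ⟨
    ∑ (suc m ℕ.+ i) lhs       ≡⟨ ∑-shift m i lhs rhs lhs-tail≡0 rhs≡0 lhs≡rhs ⟩
    ∑ (i ℕ.+ suc m) rhs       ≡⟨ cong (λ j → ∑ j rhs) (trans (ℕP.+-suc i m) (cong suc (ℕP.m+[n∸m]≡n i≤n))) ⟩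
    ∑ (suc n) rhs             ∎
    where
    m = n ∸ i
    lhs-tail≡0 : ∀ {k} → k < i → lhs (suc m ℕ.+ k) ≡ 0ℚ
    lhs-tail≡0 {k} k<i = lhs≡0 {suc m ℕ.+ k} (n∸i<j⇒n∸j<i (ℕP.≤-<-trans z≤n k<i) i≤n (s≤s (ℕP.m≤m+n m k)))
    lhs≡rhs : ∀ {k} → k < suc m → lhs k ≡ rhs (i ℕ.+ k)
    lhs≡rhs {k} k<1+m = trans (S-coeff*[n∸k]Ci r {n} {k} {i} y i+k≤n)
      (cong (ℕtoℚ (n C (i ℕ.+ k)) * y ^Q (n ∸ (i ℕ.+ k)) *_)
        (sym (trans (⟪S⟫δ≡S-coeff r (ℕP.m≤m+n i k)) (cong (S-coeff r (i ℕ.+ k)) (ℕP.m+n∸m≡n i k)))))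
      where
      i+k≤n : i ℕ.+ k ≤ n
      i+k≤n = subst (i ℕ.+ k ≤_) (ℕP.m+[n∸m]≡n i≤n) (ℕP.+-monoʳ-≤ i (ℕP.≤-pred k<1+m))

S-translate : ∀ r n y →
  compP (S r n) (y ∷ 1ℚ ∷ []) ≈P sumP (map (λ k → scaleP (ℕtoℚ (n C k) * (y ^Q (n ∸ k))) (S r k)) (upTo (suc n)))
S-translate r n y i = begin
  coeff (compP (S r n) (y ∷ 1ℚ ∷ [])) i
    ≡⟨ coeff≡⟪⟫δ (compP (S r n) (y ∷ 1ℚ ∷ [])) i ⟩
  ⟪ compP (S r n) (y ∷ 1ℚ ∷ []) ⟫ (δ i)
    ≡⟨ ⟪⟫-compP (S r n) (y ∷ 1ℚ ∷ []) (δ i) ⟩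
  ⟪ S r n ⟫ (λ m → ⟪ powP (y ∷ 1ℚ ∷ []) m ⟫ (δ i))
    ≡⟨ ⟪⟫-cong (S r n) (λ m → ⟪[y+x]^m⟫δ y m i) ⟩
  ⟪ S r n ⟫ (λ m → ℕtoℚ (m C i) * y ^Q (m ∸ i))
    ≡⟨ ⟪S⟫ r n (λ m → ℕtoℚ (m C i) * y ^Q (m ∸ i)) ⟩
  ∑ (suc n) (λ k → S-coeff r n k * (ℕtoℚ ((n ∸ k) C i) * y ^Q (n ∸ k ∸ i)))
    ≡⟨ ∑-translate r n y i ⟩
  ∑ (suc n) (λ k → c k * ⟪ S r k ⟫ (δ i))
    ≡⟨ ∑-cong (suc n) (λ {k} _ → ⟪⟫-scaleP (c k) (S r k) (δ i)) ⟨
  ∑ (suc n) (λ k → ⟪ scaleP (c k) (S r k) ⟫ (δ i))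
    ≡⟨ ⟪⟫-sumP (suc n) (λ k → scaleP (c k) (S r k)) (δ i) ⟨
  ⟪ sumP (map (λ k → scaleP (c k) (S r k)) (upTo (suc n))) ⟫ (δ i)
    ≡⟨ coeff≡⟪⟫δ (sumP (map (λ k → scaleP (c k) (S r k)) (upTo (suc n)))) i ⟨
  coeff (sumP (map (λ k → scaleP (c k) (S r k)) (upTo (suc n)))) i ∎
  where
  open ≡-Reasoning
  c : ℕ → ℚ
  c k = ℕtoℚ (n C k) * (y ^Q (n ∸ k))

theorem2p1 : (n r : ℕ) → 1 ≤ n → 1 ≤ r →
  (S r n ≈P sumP (map (λ k → monomial (ℕtoℚ (ff n k) * invℕ (ff (r ℕ.+ k) k) * ((- 1ℚ) ^Q k)) (n ∸ k)) (upTo (suc n))))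
  × (∀ (x : ℚ) → evalP (S r n) x ≡ ℕtoℚ r * integral01 (mulP (powP (x ∷ - 1ℚ ∷ []) n) (powP (1ℚ ∷ - 1ℚ ∷ []) (r ∸ 1))))
  × (deriv (S r n) ≈P scaleP (ℕtoℚ n) (S r (n ∸ 1)))
  × (∀ (y : ℚ) → compP (S r n) (y ∷ 1ℚ ∷ []) ≈P sumP (map (λ k → scaleP (ℕtoℚ (n C k) * (y ^Q (n ∸ k))) (S r k)) (upTo (suc n))))
  × IsDenomP ((r ℕ.+ n) C r) (S r n)
  × (∀ (ℓ : ℤ) → ↧ₙ (evalP (S r n) (ℓ / 1)) ∣ ((r ℕ.+ n) C r))
theorem2p1 n@(suc m) r@(suc R) _ _ =
  S≈falling r n , S≡[1+R]*∫ R n , deriv-S r m , S-translate r n , IsDenomP-S r n , ↧ₙ[S-at-ℤ]∣ r n
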